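{- Let $p>3$ be a prime with $p\equiv 3\pmod 4$, and let $\delta$ be an integer with $24\delta\equiv 1\pmod{p^2}$. Then $$\mathrm{cp}_{3,1,4}(p^2k+pt-5\delta)\equiv 0\pmod 2$$ for every $t\in\{1,2,\dots,p-1\}$ and every nonnegative integer $k$.
   Context: For integers $a,b,m\ge1$, an $(a,b,m)$-copartition is a triple of integer partitions $(\gamma,\rho,\sigma)$ such that every part of $\gamma$ is $\ge a$ and $\equiv a \pmod m$, every part of $\sigma$ is $\ge b$ and $\equiv b\pmod m$, and $\rho$ has exactly as many parts as $\sigma$, each part of $\rho$ being equal to $m$ times the number of parts of $\gamma$. Its size is the sum of all parts of $\gamma,\rho,\sigma$, and $\mathrm{cp}_{a,b,m}(n)$ denotes the number of $(a,b,m)$-copartitions of size $n$ (so $\mathrm{cp}_{a,b,m}(n)=0$ for $n<0$). -}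

module Defs where

open import Data.Nat using (ℕ; zero; suc; _+_; _*_; _∸_; _≤?_; _≟_)
open import Data.Nat.Divisibility using (_∣?_)
open import Data.Integer using (ℤ; +_; -[1+_])
open import Data.List using (List; []; _∷_; _++_; map; concatMap; length; upTo; replicate; filter)
open import Data.Nat.ListAction using (sum)
open import Data.Bool using (Bool; true; false; _∧_; if_then_else_)
open import Data.Product using (_×_; _,_)
open import Relation.Nullary.Decidable using (⌊_⌋)

-- A partition is a weakly decreasing list of positive parts.
-- partsUpTo P n k : all partitions of n whose parts lie in {1..k} and satisfy P,
-- each listed exactly once (as a weakly decreasing list).
partsUpTo : (ℕ → Bool) → ℕ → ℕ → List (List ℕ)
partsUpTo P zero    zero    = [] ∷ []
partsUpTo P (suc n) zero    = []
partsUpTo P n       (suc k) =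
  concatMap
    (λ c → if ⌊ c * suc k ≤? n ⌋ ∧ (P (suc k) ∨0 c)
           then map (replicate c (suc k) ++_) (partsUpTo P (n ∸ c * suc k) k)
           else [])
    (upTo (suc n))
  where
    _∨0_ : Bool → ℕ → Bool
    b ∨0 zero  = true
    b ∨0 suc _ = b

partitions : (ℕ → Bool) → ℕ → List (List ℕ)
partitions P n = partsUpTo P n n

admissible : ℕ → ℕ → ℕ → Bool
admissible a m x = ⌊ a ≤? x ⌋ ∧ ⌊ m ∣? (x ∸ a) ⌋

-- The list of all (a,b,m)-copartitions (γ, ρ, σ) of size n:
-- γ has parts ≥ a, ≡ a (mod m); σ has parts ≥ b, ≡ b (mod m);
-- ρ has length σ parts, each equal to m * (number of parts of γ).
copartitions : ℕ → ℕ → ℕ → ℕ → List (List ℕ × List ℕ × List ℕ)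
copartitions a b m n =
  concatMap (λ g →
    concatMap (λ γ →
      concatMap (λ s →
        concatMap (λ σ →
          let ρ = replicate (length σ) (m * length γ) in
          if ⌊ sum γ + sum ρ + sum σ ≟ n ⌋ then (γ , ρ , σ) ∷ [] else [])
        (partitions (admissible b m) s))
      (upTo (suc n)))
    (partitions (admissible a m) g))
  (upTo (suc n))

cpℕ : ℕ → ℕ → ℕ → ℕ → ℕ
cpℕ a b m n = length (copartitions a b m n)

cp : ℕ → ℕ → ℕ → ℤ → ℕ
cp a b m (+ n)     = cpℕ a b m n
cp a b m -[1+ n ]  = 0

module Submission where

-- Power series over GF(2) are modelled as ℕ → Bool and infinite products are truncated, so identities
-- hold modulo q^(N+1). Modulo 2 the generating function of cp_{3,1,4} is
-- (q⁴; q⁴)_∞ / ((q; q⁴)_∞ (q³; q⁴)_∞) = (q⁴; q⁴)_∞ / (q; q²)_∞ ≡ (q⁴; q⁴)_∞ (q; q)_∞, because (q; q)_∞ (q; q²)_∞ ≡ 1.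
-- By Euler's pentagonal theorem an odd coefficient at n forces n = 4 y + y′ with y, y′ generalized pentagonal,
-- so 24 n + 5 = v² + 4 w². A prime p ≡ 3 (mod 4) dividing v² + 4 w² divides v and w, so p² | 24 n + 5;
-- for n = p² k + p t − 5 δ with 24 δ ≡ 1 (mod p²) this says p² | 24 p t, impossible when p > 3 and 0 < t < p.

module XorSums where

  open import Data.Bool using (Bool; true; false; _xor_; _∧_; not)
  open import Data.Bool.Properties using (xor-assoc; xor-identityʳ; not-distribˡ-xor; not-involutive)
  open import Data.Bool.Solver using (module xor-∧-Solver)
  open import Data.List using (List; []; _∷_; _++_; map; concatMap; length; applyUpTo)
  open import Data.List.Properties using (length-++)
  open import Data.Nat using (ℕ; zero; suc; _+_; _∸_; _≤_; _<_; z≤n; s≤s)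
  open import Data.Nat.Properties
  open import Data.Nat.Divisibility using (_∣_; divides)
  open import Data.Product using (Σ; _×_; _,_)
  open import Function using (_∘_)
  open import Relation.Binary.PropositionalEquality
  open xor-∧-Solver using (solve; _:+_; _:=_)

  odd : ℕ → Bool
  odd zero    = false
  odd (suc n) = not (odd n)

  odd-+ : ∀ m n → odd (m + n) ≡ odd m xor odd n
  odd-+ zero    n = refl
  odd-+ (suc m) n = trans (cong not (odd-+ m n)) (not-distribˡ-xor (odd m) (odd n))

  odd≡false⇒2∣ : ∀ n → odd n ≡ false → 2 ∣ n
  odd≡false⇒2∣ zero          _ = divides 0 refl
  odd≡false⇒2∣ (suc zero)    ()
  odd≡false⇒2∣ (suc (suc n)) h with odd≡false⇒2∣ n (trans (sym (not-involutive (odd n))) h)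
  ... | divides q n≡q*2 = divides (suc q) (cong (suc ∘ suc) n≡q*2)

  ⨁∈ : {A : Set} → List A → (A → Bool) → Bool
  ⨁∈ []       h = false
  ⨁∈ (x ∷ xs) h = h x xor ⨁∈ xs h

  syntax ⨁∈ xs (λ x → e) = ⨁[ x ∈ xs ] e

  ⨁∈-cong : {A : Set} (xs : List A) {h h′ : A → Bool} → (∀ x → h x ≡ h′ x) → ⨁∈ xs h ≡ ⨁∈ xs h′
  ⨁∈-cong []       h≡h′ = refl
  ⨁∈-cong (x ∷ xs) h≡h′ = cong₂ _xor_ (h≡h′ x) (⨁∈-cong xs h≡h′)

  ⨁∈-++ : {A : Set} (xs ys : List A) (h : A → Bool) → ⨁∈ (xs ++ ys) h ≡ ⨁∈ xs h xor ⨁∈ ys h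
  ⨁∈-++ []       ys h = refl
  ⨁∈-++ (x ∷ xs) ys h = trans (cong (h x xor_) (⨁∈-++ xs ys h)) (sym (xor-assoc (h x) (⨁∈ xs h) (⨁∈ ys h)))

  ⨁∈-map : {A B : Set} (g : A → B) (xs : List A) (h : B → Bool) → ⨁∈ (map g xs) h ≡ ⨁∈ xs (h ∘ g)
  ⨁∈-map g []       h = refl
  ⨁∈-map g (x ∷ xs) h = cong (h (g x) xor_) (⨁∈-map g xs h)

  ⨁∈-concatMap : {A B : Set} (g : A → List B) (xs : List A) (h : B → Bool) →
    ⨁∈ (concatMap g xs) h ≡ ⨁[ x ∈ xs ] ⨁∈ (g x) h
  ⨁∈-concatMap g []       h = refl
  ⨁∈-concatMap g (x ∷ xs) h = trans (⨁∈-++ (g x) (concatMap g xs) h) (cong (⨁∈ (g x) h xor_) (⨁∈-concatMap g xs h))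

  odd-length-concatMap : {A B : Set} (g : A → List B) (xs : List A) →
    odd (length (concatMap g xs)) ≡ ⨁[ x ∈ xs ] odd (length (g x))
  odd-length-concatMap g []       = refl
  odd-length-concatMap g (x ∷ xs) = trans (cong odd (length-++ (g x)))
    (trans (odd-+ (length (g x)) _) (cong (odd (length (g x)) xor_) (odd-length-concatMap g xs)))

  ⨁∈-false : {A : Set} (xs : List A) {h : A → Bool} → (∀ x → h x ≡ false) → ⨁∈ xs h ≡ false
  ⨁∈-false []       h≡false = refl
  ⨁∈-false (x ∷ xs) h≡false rewrite h≡false x = ⨁∈-false xs h≡false

  ⨁∈-xor : {A : Set} (xs : List A) (h h′ : A → Bool) → ⨁[ x ∈ xs ] (h x xor h′ x) ≡ ⨁∈ xs h xor ⨁∈ xs h′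
  ⨁∈-xor []       h h′ = refl
  ⨁∈-xor (x ∷ xs) h h′ rewrite ⨁∈-xor xs h h′ =
    solve 4 (λ a b c d → (a :+ b) :+ (c :+ d) := (a :+ c) :+ (b :+ d)) refl (h x) (h′ x) (⨁∈ xs h) (⨁∈ xs h′)

  ⨁< : ℕ → (ℕ → Bool) → Bool
  ⨁< zero    h = false
  ⨁< (suc c) h = h 0 xor ⨁< c (h ∘ suc)

  syntax ⨁< c (λ i → e) = ⨁[ i < c ] e

  ⨁∈-applyUpTo : {A : Set} (g : ℕ → A) (c : ℕ) (h : A → Bool) → ⨁∈ (applyUpTo g c) h ≡ ⨁< c (h ∘ g)
  ⨁∈-applyUpTo g zero    h = refl
  ⨁∈-applyUpTo g (suc c) h = cong (h (g 0) xor_) (⨁∈-applyUpTo (g ∘ suc) c h)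

  ⨁<-cong : ∀ c {h h′ : ℕ → Bool} → (∀ i → i < c → h i ≡ h′ i) → ⨁< c h ≡ ⨁< c h′
  ⨁<-cong zero    h≡h′ = refl
  ⨁<-cong (suc c) h≡h′ = cong₂ _xor_ (h≡h′ 0 (s≤s z≤n)) (⨁<-cong c (λ i i<c → h≡h′ (suc i) (s≤s i<c)))

  ⨁<-false : ∀ c {h : ℕ → Bool} → (∀ i → i < c → h i ≡ false) → ⨁< c h ≡ false
  ⨁<-false zero    h≡false = refl
  ⨁<-false (suc c) h≡false rewrite h≡false 0 (s≤s z≤n) = ⨁<-false c (λ i i<c → h≡false (suc i) (s≤s i<c))

  ∧≡true : ∀ {a b} → a ∧ b ≡ true → a ≡ true × b ≡ true
  ∧≡true {true} {true} _ = refl , refl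

  ⨁<-true : ∀ c (h : ℕ → Bool) → ⨁< c h ≡ true → Σ ℕ λ i → i < c × h i ≡ true
  ⨁<-true zero    h ()
  ⨁<-true (suc c) h ⨁≡true with h 0 in h0
  ... | true  = 0 , s≤s z≤n , h0
  ... | false with ⨁<-true c (λ i → h (suc i)) ⨁≡true
  ...   | i , i<c , hi = suc i , s≤s i<c , hi

  ⨁<-xor : ∀ c (h h′ : ℕ → Bool) → ⨁[ i < c ] (h i xor h′ i) ≡ ⨁< c h xor ⨁< c h′
  ⨁<-xor zero    h h′ = refl
  ⨁<-xor (suc c) h h′ rewrite ⨁<-xor c (h ∘ suc) (h′ ∘ suc) =
    solve 4 (λ a b x y → (a :+ b) :+ (x :+ y) := (a :+ x) :+ (b :+ y)) refl (h 0) (h′ 0) (⨁< c (h ∘ suc)) (⨁< c (h′ ∘ suc))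

  ⨁<-∧ : ∀ c b (h : ℕ → Bool) → ⨁[ i < c ] (b ∧ h i) ≡ b ∧ ⨁< c h
  ⨁<-∧ c false h = ⨁<-false c (λ _ _ → refl)
  ⨁<-∧ c true  h = refl

  ⨁<-+ : ∀ a b (h : ℕ → Bool) → ⨁< (a + b) h ≡ ⨁< a h xor ⨁[ i < b ] h (a + i)
  ⨁<-+ zero    b h = refl
  ⨁<-+ (suc a) b h = trans (cong (h 0 xor_) (⨁<-+ a b (h ∘ suc))) (sym (xor-assoc (h 0) _ _))

  ⨁<-vanishing-tail : ∀ a c (h : ℕ → Bool) → a ≤ c → (∀ i → a ≤ i → i < c → h i ≡ false) → ⨁< c h ≡ ⨁< a h
  ⨁<-vanishing-tail a c h a≤c tail≡false = begin
    ⨁< c h                                ≡⟨ cong (λ c → ⨁< c h) (m+[n∸m]≡n a≤c) ⟨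
    ⨁< (a + (c ∸ a)) h                    ≡⟨ ⨁<-+ a (c ∸ a) h ⟩
    ⨁< a h xor ⨁[ i < c ∸ a ] h (a + i)   ≡⟨ cong (⨁< a h xor_) (⨁<-false (c ∸ a) (λ i i<c∸a →
                                               tail≡false (a + i) (m≤m+n a i) (subst (a + i <_) (m+[n∸m]≡n a≤c) (+-monoʳ-< a i<c∸a)))) ⟩
    ⨁< a h xor false                      ≡⟨ xor-identityʳ _ ⟩
    ⨁< a h                                ∎
    where open ≡-Reasoning


module Series where

  open XorSums
  open import Data.Bool using (Bool; true; false; _xor_; _∧_)
  open import Data.Bool.Properties using (xor-same; xor-identityʳ; ∧-distribʳ-xor; ∧-zeroˡ; ∧-zeroʳ)
  open import Data.List using (List; []; _∷_)
  open import Data.Bool.Solver using (module xor-∧-Solver)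
  open import Data.Nat using (ℕ; zero; suc; _+_; _*_; _∸_; _≤_; _<_; s≤s; _<?_; >-nonZero)
  open import Data.Nat.Properties
  open import Data.Nat.Induction using (<-rec)
  open import Data.Nat.Tactic.RingSolver using (solve-∀)
  open import Data.Sum using (inj₁; inj₂)
  open import Relation.Nullary using (yes; no)
  open import Relation.Binary.PropositionalEquality
  open xor-∧-Solver using (solve; _:+_; _:=_)

  Series : Set
  Series = ℕ → Bool

  infixl 6 _⊕_
  _⊕_ : Series → Series → Series
  (f ⊕ g) n = f n xor g n

  0ₛ : Series
  0ₛ _ = false

  1ₛ : Series
  1ₛ zero    = true
  1ₛ (suc _) = false

  infix 4 _≐_ _≈[_]_
  _≐_ : Series → Series → Set
  f ≐ g = ∀ n → f n ≡ g n

  _≈[_]_ : Series → ℕ → Series → Set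
  f ≈[ N ] g = ∀ n → n ≤ N → f n ≡ g n

  ≐⇒≈ : ∀ {f g} N → f ≐ g → f ≈[ N ] g
  ≐⇒≈ N f≐g n _ = f≐g n

  ≈-refl : ∀ {f} N → f ≈[ N ] f
  ≈-refl N n _ = refl

  ≈-sym : ∀ {f g} N → f ≈[ N ] g → g ≈[ N ] f
  ≈-sym N f≈g n n≤N = sym (f≈g n n≤N)

  ≈-trans : ∀ {f g h} N → f ≈[ N ] g → g ≈[ N ] h → f ≈[ N ] h
  ≈-trans N f≈g g≈h n n≤N = trans (f≈g n n≤N) (g≈h n n≤N)

  ⊕-≈ : ∀ {f g f′ g′} N → f ≈[ N ] f′ → g ≈[ N ] g′ → f ⊕ g ≈[ N ] f′ ⊕ g′
  ⊕-≈ N f≈f′ g≈g′ n n≤N = cong₂ _xor_ (f≈f′ n n≤N) (g≈g′ n n≤N)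

  xor≡false⇒≡ : ∀ {a b} → a xor b ≡ false → a ≡ b
  xor≡false⇒≡ {false} {false} _ = refl
  xor≡false⇒≡ {true}  {true}  _ = refl

  ⊕-cancel : ∀ {f g} N → f ⊕ g ≈[ N ] 0ₛ → f ≈[ N ] g
  ⊕-cancel N f⊕g≈0 n n≤N = xor≡false⇒≡ (f⊕g≈0 n n≤N)

  shift : ℕ → Series → Series
  shift zero    f         = f
  shift (suc e) f zero    = false
  shift (suc e) f (suc n) = shift e f n

  shift-cong : ∀ e {f g} → f ≐ g → shift e f ≐ shift e g
  shift-cong zero    f≐g n       = f≐g n
  shift-cong (suc e) f≐g zero    = refl
  shift-cong (suc e) f≐g (suc n) = shift-cong e f≐g n

  shift-≈ : ∀ e {f g} N → f ≈[ N ] g → shift e f ≈[ N ] shift e g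
  shift-≈ zero    N f≈g n       n≤N = f≈g n n≤N
  shift-≈ (suc e) N f≈g zero    _   = refl
  shift-≈ (suc e) N f≈g (suc n) n<N = shift-≈ e N f≈g n (<⇒≤ n<N)

  shift-exponent : ∀ {a b} f → a ≡ b → shift a f ≐ shift b f
  shift-exponent f refl n = refl

  shift-+ : ∀ a b f → shift a (shift b f) ≐ shift (a + b) f
  shift-+ zero    b f n       = refl
  shift-+ (suc a) b f zero    = refl
  shift-+ (suc a) b f (suc n) = shift-+ a b f n

  shift-comm : ∀ a b f → shift a (shift b f) ≐ shift b (shift a f)
  shift-comm a b f n = begin
    shift a (shift b f) n  ≡⟨ shift-+ a b f n ⟩
    shift (a + b) f n      ≡⟨ shift-exponent f (+-comm a b) n ⟩
    shift (b + a) f n      ≡⟨ shift-+ b a f n ⟨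
    shift b (shift a f) n  ∎
    where open ≡-Reasoning

  shift-⊕ : ∀ e f g → shift e (f ⊕ g) ≐ shift e f ⊕ shift e g
  shift-⊕ zero    f g n       = refl
  shift-⊕ (suc e) f g zero    = refl
  shift-⊕ (suc e) f g (suc n) = shift-⊕ e f g n

  shift-0ₛ : ∀ e → shift e 0ₛ ≐ 0ₛ
  shift-0ₛ zero    n       = refl
  shift-0ₛ (suc e) zero    = refl
  shift-0ₛ (suc e) (suc n) = shift-0ₛ e n

  shift-map : ∀ e (h : Bool → Bool) f → h false ≡ false → shift e (λ m → h (f m)) ≐ (λ n → h (shift e f n))
  shift-map zero    h f h0 n       = refl
  shift-map (suc e) h f h0 zero    = sym h0
  shift-map (suc e) h f h0 (suc n) = shift-map e h f h0 n

  shift-below : ∀ e f {n} → n < e → shift e f n ≡ false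
  shift-below (suc e) f {zero}  _         = refl
  shift-below (suc e) f {suc n} (s≤s n<e) = shift-below e f n<e

  shift-+-at : ∀ e f n → shift e f (e + n) ≡ f n
  shift-+-at zero    f n = refl
  shift-+-at (suc e) f n = shift-+-at e f n

  shift-beyond : ∀ e f N → N < e → shift e f ≈[ N ] 0ₛ
  shift-beyond e f N N<e n n≤N = shift-below e f (≤-<-trans n≤N N<e)

  shift-at : ∀ e f {n} → e ≤ n → shift e f n ≡ f (n ∸ e)
  shift-at e f {n} e≤n = begin
    shift e f n             ≡⟨ cong (shift e f) (m+[n∸m]≡n e≤n) ⟨
    shift e f (e + (n ∸ e)) ≡⟨ shift-+-at e f (n ∸ e) ⟩
    f (n ∸ e)               ∎
    where open ≡-Reasoning

  ⨁∈-shift : {A : Set} (xs : List A) (e : ℕ) (F : A → Series) (n : ℕ) →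
    ⨁[ x ∈ xs ] shift e (F x) n ≡ shift e (λ r → ⨁[ x ∈ xs ] F x r) n
  ⨁∈-shift []       e F n = sym (shift-0ₛ e n)
  ⨁∈-shift (x ∷ xs) e F n = trans (cong (shift e (F x) n xor_) (⨁∈-shift xs e F n)) (sym (shift-⊕ e (F x) _ n))

  shift-unique : ∀ e f g → (∀ n → n < e → g n ≡ false) → (∀ m → g (e + m) ≡ f m) → shift e f ≐ g
  shift-unique e f g low high n with n <? e
  ... | yes n<e = trans (shift-below e f n<e) (sym (low n n<e))
  ... | no  n≮e = begin
    shift e f n      ≡⟨ shift-at e f (≮⇒≥ n≮e) ⟩
    f (n ∸ e)        ≡⟨ high (n ∸ e) ⟨
    g (e + (n ∸ e))  ≡⟨ cong g (m+[n∸m]≡n (≮⇒≥ n≮e)) ⟩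
    g n              ∎
    where open ≡-Reasoning

  q^_ : ℕ → Series
  q^ c = shift c 1ₛ

  q^-coefficient : ∀ c n → (q^ c) n ≡ true → n ≡ c
  q^-coefficient zero    zero    _ = refl
  q^-coefficient (suc c) (suc n) h = cong suc (q^-coefficient c n h)

  infixr 7 [1+q^_]*_
  [1+q^_]*_ : ℕ → Series → Series
  [1+q^ e ]* f = f ⊕ shift e f

  [1+q^]-cong : ∀ e {f g} → f ≐ g → [1+q^ e ]* f ≐ [1+q^ e ]* g
  [1+q^]-cong e f≐g n = cong₂ _xor_ (f≐g n) (shift-cong e f≐g n)

  [1+q^]-≈ : ∀ e {f g} N → f ≈[ N ] g → [1+q^ e ]* f ≈[ N ] [1+q^ e ]* g
  [1+q^]-≈ e N f≈g = ⊕-≈ N f≈g (shift-≈ e N f≈g)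

  [1+q^]-exponent : ∀ {a b} f → a ≡ b → [1+q^ a ]* f ≐ [1+q^ b ]* f
  [1+q^]-exponent f refl n = refl

  [1+q^]-⊕ : ∀ e f g → [1+q^ e ]* (f ⊕ g) ≐ [1+q^ e ]* f ⊕ [1+q^ e ]* g
  [1+q^]-⊕ e f g n rewrite shift-⊕ e f g n =
    solve 4 (λ a b c d → (a :+ b) :+ (c :+ d) := (a :+ c) :+ (b :+ d)) refl (f n) (g n) (shift e f n) (shift e g n)

  [1+q^]-shift : ∀ e c f → [1+q^ e ]* shift c f ≐ shift c ([1+q^ e ]* f)
  [1+q^]-shift e c f n = begin
    shift c f n xor shift e (shift c f) n ≡⟨ cong (shift c f n xor_) (shift-comm e c f n) ⟩
    shift c f n xor shift c (shift e f) n ≡⟨ shift-⊕ c f (shift e f) n ⟨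
    shift c ([1+q^ e ]* f) n              ∎
    where open ≡-Reasoning

  [1+q^]-comm : ∀ a b f → [1+q^ a ]* [1+q^ b ]* f ≐ [1+q^ b ]* [1+q^ a ]* f
  [1+q^]-comm a b f n
    rewrite shift-⊕ a f (shift b f) n | shift-⊕ b f (shift a f) n | shift-comm a b f n =
    solve 4 (λ x y z w → (x :+ y) :+ (z :+ w) := (x :+ z) :+ (y :+ w)) refl
      (f n) (shift b f n) (shift a f n) (shift b (shift a f) n)

  [1+q^]-beyond : ∀ e f N → N < e → [1+q^ e ]* f ≈[ N ] f
  [1+q^]-beyond e f N N<e n n≤N = trans (cong (f n xor_) (shift-beyond e f N N<e n n≤N)) (xor-identityʳ (f n))

  [1+q^]-⊕-shift : ∀ a b f → [1+q^ a ]* f ⊕ shift a ([1+q^ b ]* f) ≐ [1+q^ (a + b) ]* f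
  [1+q^]-⊕-shift a b f n rewrite shift-⊕ a f (shift b f) n | shift-+ a b f n =
    solve 3 (λ x y z → (x :+ y) :+ (y :+ z) := x :+ z) refl (f n) (shift a f n) (shift (a + b) f n)

  [1+q^]-square : ∀ e f → [1+q^ e ]* [1+q^ e ]* f ≐ [1+q^ (e + e) ]* f
  [1+q^]-square e = [1+q^]-⊕-shift e e

  shift-fixpoint-vanishes : ∀ {X : Set} (D : X → Series) (σ : X → X) e b → 1 ≤ e →
    (∀ x → D x ≐ (λ n → b ∧ shift e (D (σ x)) n)) → ∀ x → D x ≐ 0ₛ
  shift-fixpoint-vanishes D σ e b 1≤e D≐ x n = <-rec (λ n → ∀ x → D x n ≡ false) vanish n x
    where
    vanish : ∀ n → (∀ {m} → m < n → ∀ x → D x m ≡ false) → ∀ x → D x n ≡ false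
    vanish n ih x with n <? e
    ... | yes n<e = trans (D≐ x n) (trans (cong (b ∧_) (shift-below e (D (σ x)) n<e)) (∧-zeroʳ b))
    ... | no  n≮e = trans (D≐ x n) (trans (cong (b ∧_) (trans (shift-at e (D (σ x)) (≮⇒≥ n≮e))
                      (ih (∸-monoʳ-< 1≤e (≮⇒≥ n≮e)) (σ x)))) (∧-zeroʳ b))

  [1+q^]-cancel : ∀ e {f g} N → 1 ≤ e → [1+q^ e ]* f ≈[ N ] [1+q^ e ]* g → f ≈[ N ] g
  [1+q^]-cancel e {f} {g} N 1≤e eq = ⊕-cancel N (λ n → <-rec (λ n → n ≤ N → h n ≡ false) vanish n)
    where
    h = f ⊕ g
    [1+q^e]h≡0 : ∀ n → n ≤ N → h n xor shift e h n ≡ false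
    [1+q^e]h≡0 n n≤N = trans ([1+q^]-⊕ e f g n) (trans (cong (_xor ([1+q^ e ]* g) n) (eq n n≤N)) (xor-same (([1+q^ e ]* g) n)))
    vanish : ∀ n → (∀ {m} → m < n → m ≤ N → h m ≡ false) → n ≤ N → h n ≡ false
    vanish n ih n≤N with n <? e
    ... | yes n<e = trans (sym (xor-identityʳ (h n)))
                      (trans (cong (h n xor_) (sym (shift-below e h n<e))) ([1+q^e]h≡0 n n≤N))
    ... | no  n≮e = begin
      h n             ≡⟨ xor≡false⇒≡ ([1+q^e]h≡0 n n≤N) ⟩
      shift e h n     ≡⟨ shift-at e h (≮⇒≥ n≮e) ⟩
      h (n ∸ e)       ≡⟨ ih (∸-monoʳ-< 1≤e (≮⇒≥ n≮e)) (≤-trans (m∸n≤m n e) n≤N) ⟩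
      false           ∎
      where open ≡-Reasoning

  [1+q^]-monomial : ∀ e c → [1+q^ e ]* q^ c ≐ q^ c ⊕ q^ (c + e)
  [1+q^]-monomial e c n = trans ([1+q^]-shift e c 1ₛ n)
    (trans (shift-⊕ c 1ₛ (shift e 1ₛ) n) (cong ((q^ c) n xor_) (shift-+ c e 1ₛ n)))

  -- poch α β c f = (1 + q^α) (1 + q^(α+β)) ⋯ (1 + q^(α+(c-1)β)) f, the mod-2 image of (q^α; q^β)_c f
  poch : ℕ → ℕ → ℕ → Series → Series
  poch α β zero    f = f
  poch α β (suc c) f = [1+q^ α ]* poch (α + β) β c f

  poch-cong : ∀ α β c {f g} → f ≐ g → poch α β c f ≐ poch α β c g
  poch-cong α β zero    f≐g = f≐g
  poch-cong α β (suc c) f≐g = [1+q^]-cong α (poch-cong (α + β) β c f≐g)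

  poch-≈ : ∀ α β c {f g} N → f ≈[ N ] g → poch α β c f ≈[ N ] poch α β c g
  poch-≈ α β zero    N f≈g = f≈g
  poch-≈ α β (suc c) N f≈g = [1+q^]-≈ α N (poch-≈ (α + β) β c N f≈g)

  poch-start : ∀ {α α′} β c f → α ≡ α′ → poch α β c f ≐ poch α′ β c f
  poch-start β c f refl n = refl

  poch-length : ∀ α β {c c′} f → c ≡ c′ → poch α β c f ≐ poch α β c′ f
  poch-length α β f refl n = refl

  poch-⊕ : ∀ α β c f g → poch α β c (f ⊕ g) ≐ poch α β c f ⊕ poch α β c g
  poch-⊕ α β zero    f g n = refl
  poch-⊕ α β (suc c) f g n = trans ([1+q^]-cong α (poch-⊕ (α + β) β c f g) n) ([1+q^]-⊕ α (poch (α + β) β c f) (poch (α + β) β c g) n)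

  poch-shift : ∀ α β c e f → poch α β c (shift e f) ≐ shift e (poch α β c f)
  poch-shift α β zero    e f n = refl
  poch-shift α β (suc c) e f n = trans ([1+q^]-cong α (poch-shift (α + β) β c e f) n) ([1+q^]-shift α e (poch (α + β) β c f) n)

  poch-[1+q^] : ∀ α β c e f → poch α β c ([1+q^ e ]* f) ≐ [1+q^ e ]* poch α β c f
  poch-[1+q^] α β zero    e f n = refl
  poch-[1+q^] α β (suc c) e f n = trans ([1+q^]-cong α (poch-[1+q^] (α + β) β c e f) n) ([1+q^]-comm α e (poch (α + β) β c f) n)

  poch-comm : ∀ α β c α′ β′ c′ f → poch α β c (poch α′ β′ c′ f) ≐ poch α′ β′ c′ (poch α β c f)
  poch-comm α β c α′ β′ zero     f n = refl
  poch-comm α β c α′ β′ (suc c′) f n =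
    trans (poch-[1+q^] α β c α′ (poch (α′ + β′) β′ c′ f) n) ([1+q^]-cong α′ (poch-comm α β c (α′ + β′) β′ c′ f) n)

  poch-beyond : ∀ α β c f N → N < α → poch α β c f ≈[ N ] f
  poch-beyond α β zero    f N N<α = ≈-refl N
  poch-beyond α β (suc c) f N N<α =
    ≈-trans N ([1+q^]-beyond α _ N N<α) (poch-beyond (α + β) β c f N (<-≤-trans N<α (m≤m+n α β)))

  poch-+ : ∀ α β c d f → poch α β (c + d) f ≐ poch α β c (poch (α + β * c) β d f)
  poch-+ α β zero    d f = poch-start β d f (sym (trans (cong (α +_) (*-zeroʳ β)) (+-identityʳ α)))
  poch-+ α β (suc c) d f = [1+q^]-cong α (λ n → trans (poch-+ (α + β) β c d f n)
    (poch-cong (α + β) β c (poch-start β d f (trans (+-assoc α β (β * c)) (cong (α +_) (sym (*-suc β c))))) n))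

  poch-snoc : ∀ α β c f → poch α β (suc c) f ≐ [1+q^ (α + β * c) ]* poch α β c f
  poch-snoc α β c f n = begin
    poch α β (suc c) f n                           ≡⟨ poch-length α β f (+-comm 1 c) n ⟩
    poch α β (c + 1) f n                           ≡⟨ poch-+ α β c 1 f n ⟩
    poch α β c ([1+q^ (α + β * c) ]* f) n          ≡⟨ poch-[1+q^] α β c (α + β * c) f n ⟩
    ([1+q^ (α + β * c) ]* poch α β c f) n          ∎
    where open ≡-Reasoning

  poch-truncate : ∀ α β c d f N → 1 ≤ β → N < c → poch α β (c + d) f ≈[ N ] poch α β c f
  poch-truncate α β c d f N 1≤β N<c n n≤N = trans (poch-+ α β c d f n)
    (poch-≈ α β c N (poch-beyond (α + β * c) β d f N N<α+βc) n n≤N)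
    where
    N<α+βc : N < α + β * c
    N<α+βc = <-≤-trans N<c (≤-trans (m≤n*m c β {{>-nonZero 1≤β}}) (m≤n+m (β * c) α))

  poch-≈-length : ∀ α β {c c′} f N → 1 ≤ β → N < c → N < c′ → poch α β c f ≈[ N ] poch α β c′ f
  poch-≈-length α β {c} {c′} f N 1≤β N<c N<c′ with ≤-total c c′
  ... | inj₁ c≤c′ = ≈-sym N (≈-trans N (≐⇒≈ N (poch-length α β f (sym (m+[n∸m]≡n c≤c′))))
                      (poch-truncate α β c (c′ ∸ c) f N 1≤β N<c))
  ... | inj₂ c′≤c = ≈-trans N (≐⇒≈ N (poch-length α β f (sym (m+[n∸m]≡n c′≤c))))
                      (poch-truncate α β c′ (c ∸ c′) f N 1≤β N<c′)

  poch-interleave : ∀ α β c f → poch α (β + β) c (poch (α + β) (β + β) c f) ≐ poch α β (c + c) f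
  poch-interleave α β zero    f n = refl
  poch-interleave α β (suc c) f n = begin
    ([1+q^ α ]* poch (α + (β + β)) (β + β) c ([1+q^ (α + β) ]* poch (α + β + (β + β)) (β + β) c f)) n
      ≡⟨ [1+q^]-cong α (poch-[1+q^] (α + (β + β)) (β + β) c (α + β) _) n ⟩
    ([1+q^ α ]* [1+q^ (α + β) ]* poch (α + (β + β)) (β + β) c (poch (α + β + (β + β)) (β + β) c f)) n
      ≡⟨ [1+q^]-cong α ([1+q^]-cong (α + β) (λ m →
           trans (poch-cong (α + (β + β)) (β + β) c (poch-start (β + β) c f (reassoc α β)) m)
                 (poch-interleave (α + (β + β)) β c f m))) n ⟩
    ([1+q^ α ]* [1+q^ (α + β) ]* poch (α + (β + β)) β (c + c) f) n
      ≡⟨ [1+q^]-cong α ([1+q^]-cong (α + β) (poch-start β (c + c) f (sym (+-assoc α β β)))) n ⟩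
    poch α β (suc (suc (c + c))) f n
      ≡⟨ poch-length α β f (cong suc (sym (+-suc c c))) n ⟩
    poch α β (suc c + suc c) f n ∎
    where
    open ≡-Reasoning
    reassoc : ∀ α β → α + β + (β + β) ≡ α + (β + β) + β
    reassoc = solve-∀

  poch-square : ∀ α β c f → poch α β c (poch α β c f) ≐ poch (α + α) (β + β) c f
  poch-square α β zero    f n = refl
  poch-square α β (suc c) f n = begin
    ([1+q^ α ]* poch (α + β) β c ([1+q^ α ]* poch (α + β) β c f)) n
      ≡⟨ [1+q^]-cong α (poch-[1+q^] (α + β) β c α _) n ⟩
    ([1+q^ α ]* [1+q^ α ]* poch (α + β) β c (poch (α + β) β c f)) n
      ≡⟨ [1+q^]-square α (poch (α + β) β c (poch (α + β) β c f)) n ⟩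
    ([1+q^ (α + α) ]* poch (α + β) β c (poch (α + β) β c f)) n
      ≡⟨ [1+q^]-cong (α + α) (λ m → trans (poch-square (α + β) β c f m)
           (poch-start (β + β) c f (swap α β) m)) n ⟩
    poch (α + α) (β + β) (suc c) f n ∎
    where
    open ≡-Reasoning
    swap : ∀ α β → (α + β) + (α + β) ≡ (α + α) + (β + β)
    swap = solve-∀

  -- Modulo 2, (q^d; q^d) (q^d; q^2d) = (q^2d; q^2d) (q^2d; q^4d); doubling d past N shows (q; q) (q; q²) ≡ 1.
  poch-inverse : ∀ c g N → N < c → poch 1 1 c (poch 1 2 c g) ≈[ N ] g
  poch-inverse c g N N<c = doubling N 1 ≤-refl ≤-refl
    where
    G : ℕ → Series
    G d = poch d d c (poch d (d + d) c g)
    G-double : ∀ d → 1 ≤ d → G d ≈[ N ] G (d + d)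
    G-double d 1≤d = ≈-trans N (poch-≈-length d d (poch d (d + d) c g) N 1≤d N<c (<-≤-trans N<c (m≤m+n c c)))
      (≐⇒≈ N (λ n → trans (sym (poch-interleave d d c (poch d (d + d) c g) n))
        (trans (poch-comm d (d + d) c (d + d) (d + d) c (poch d (d + d) c g) n)
               (poch-cong (d + d) (d + d) c (poch-square d (d + d) c g) n))))
    doubling : ∀ t d → 1 ≤ d → N < d + t → G d ≈[ N ] g
    doubling zero    d _   N<d+0 = ≈-trans N (poch-beyond d d c _ N N<d) (poch-beyond d (d + d) c g N N<d)
      where
      N<d : N < d
      N<d = subst (N <_) (+-identityʳ d) N<d+0
    doubling (suc t) d 1≤d N<d+1+t = ≈-trans N (G-double d 1≤d) (doubling t (d + d) (≤-trans 1≤d (m≤m+n d d))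
      (<-≤-trans N<d+1+t (≤-trans (≤-reflexive (+-suc d t)) (+-monoˡ-≤ t (+-monoˡ-≤ d 1≤d)))))

  -- ⨁shift F = Σ_g q^g F_g
  ⨁shift : (ℕ → Series) → Series
  ⨁shift F n = ⨁[ g < suc n ] F g (n ∸ g)

  ⨁shift-≈ : ∀ {F G} N → (∀ g → F g ≈[ N ] G g) → ⨁shift F ≈[ N ] ⨁shift G
  ⨁shift-≈ N F≈G n n≤N = ⨁<-cong (suc n) (λ g _ → F≈G g (n ∸ g) (≤-trans (m∸n≤m n g) n≤N))

  ⨁shift-cong : ∀ {F G} → (∀ g → F g ≐ G g) → ⨁shift F ≐ ⨁shift G
  ⨁shift-cong F≐G n = ⨁shift-≈ n (λ g → ≐⇒≈ n (F≐G g)) n ≤-refl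

  ⨁shift-vanish : ∀ {F} N → (∀ g → F g ≈[ N ] 0ₛ) → ⨁shift F ≈[ N ] 0ₛ
  ⨁shift-vanish N F≈0 n n≤N = ⨁<-false (suc n) (λ g _ → F≈0 g (n ∸ g) (≤-trans (m∸n≤m n g) n≤N))

  ⨁shift-⊕ : ∀ F G → ⨁shift (λ g → F g ⊕ G g) ≐ ⨁shift F ⊕ ⨁shift G
  ⨁shift-⊕ F G n = ⨁<-xor (suc n) (λ g → F g (n ∸ g)) (λ g → G g (n ∸ g))

  ⨁shift-∧ : ∀ b F → ⨁shift (λ g r → b ∧ F g r) ≐ (λ n → b ∧ ⨁shift F n)
  ⨁shift-∧ b F n = ⨁<-∧ (suc n) b (λ g → F g (n ∸ g))

  ⨁shift-shift : ∀ e F → ⨁shift (λ g → shift e (F g)) ≐ shift e (⨁shift F)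
  ⨁shift-shift e F = λ n → sym (shift-unique e (⨁shift F) (⨁shift (λ g → shift e (F g))) low high n)
    where
    low : ∀ n → n < e → ⨁shift (λ g → shift e (F g)) n ≡ false
    low n n<e = ⨁<-false (suc n) (λ g _ → shift-below e (F g) (≤-<-trans (m∸n≤m n g) n<e))
    high : ∀ m → ⨁shift (λ g → shift e (F g)) (e + m) ≡ ⨁shift F m
    high m = trans (⨁<-vanishing-tail (suc m) (suc (e + m)) _ (s≤s (m≤n+m m e))
        (λ g m<g g<1+e+m → shift-below e (F g) (subst (e + m ∸ g <_) (m+n∸n≡m e m) (∸-monoʳ-< m<g (≤-pred g<1+e+m)))))
      (⨁<-cong (suc m) (λ g g<1+m → trans (cong (shift e (F g)) (+-∸-assoc e (≤-pred g<1+m))) (shift-+-at e (F g) (m ∸ g))))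

  ⨁shift-reindex : ∀ e F → ⨁shift (λ g r → shift e (λ g′ → F g′ r) g) ≐ shift e (⨁shift F)
  ⨁shift-reindex e F = λ n → sym (shift-unique e (⨁shift F) (⨁shift (λ g r → shift e (λ g′ → F g′ r) g)) low high n)
    where
    low : ∀ n → n < e → ⨁shift (λ g r → shift e (λ g′ → F g′ r) g) n ≡ false
    low n n<e = ⨁<-false (suc n) (λ g g≤n → shift-below e (λ g′ → F g′ (n ∸ g)) (≤-<-trans (≤-pred g≤n) n<e))
    high : ∀ m → ⨁shift (λ g r → shift e (λ g′ → F g′ r) g) (e + m) ≡ ⨁shift F m
    high m = begin
      ⨁[ g < suc (e + m) ] shift e (λ g′ → F g′ (e + m ∸ g)) g
        ≡⟨ cong (λ c → ⨁[ g < c ] shift e (λ g′ → F g′ (e + m ∸ g)) g) (sym (+-suc e m)) ⟩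
      ⨁[ g < e + suc m ] shift e (λ g′ → F g′ (e + m ∸ g)) g
        ≡⟨ ⨁<-+ e (suc m) (λ g → shift e (λ g′ → F g′ (e + m ∸ g)) g) ⟩
      ⨁[ g < e ] shift e (λ g′ → F g′ (e + m ∸ g)) g xor ⨁[ i < suc m ] shift e (λ g′ → F g′ (e + m ∸ (e + i))) (e + i)
        ≡⟨ cong₂ _xor_ (⨁<-false e (λ g g<e → shift-below e _ g<e))
                       (⨁<-cong (suc m) (λ i _ → trans (shift-+-at e (λ g′ → F g′ (e + m ∸ (e + i))) i) (cong (F i) ([m+n]∸[m+o]≡n∸o e m i)))) ⟩
      false xor ⨁shift F m
        ≡⟨⟩
      ⨁shift F m ∎
      where open ≡-Reasoning

  infixl 7 _∗_
  _∗_ : Series → Series → Series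
  g ∗ f = ⨁shift (λ i r → g i ∧ f r)

  1ₛ-∗ : ∀ f → 1ₛ ∗ f ≐ f
  1ₛ-∗ f n = trans (cong (f n xor_) (⨁<-false n (λ _ _ → refl))) (xor-identityʳ (f n))

  [1+q^]-∗ : ∀ e g f → [1+q^ e ]* (g ∗ f) ≐ ([1+q^ e ]* g) ∗ f
  [1+q^]-∗ e g f n = sym (begin
    ⨁[ i < suc n ] ((g i xor shift e g i) ∧ f (n ∸ i))
      ≡⟨ ⨁<-cong (suc n) (λ i _ → ∧-distribʳ-xor (f (n ∸ i)) (g i) (shift e g i)) ⟩
    ⨁[ i < suc n ] ((g i ∧ f (n ∸ i)) xor (shift e g i ∧ f (n ∸ i)))
      ≡⟨ ⨁<-xor (suc n) (λ i → g i ∧ f (n ∸ i)) (λ i → shift e g i ∧ f (n ∸ i)) ⟩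
    (g ∗ f) n xor (shift e g ∗ f) n
      ≡⟨ cong ((g ∗ f) n xor_) (trans (⨁<-cong (suc n) (λ i _ → sym (shift-map e (_∧ f (n ∸ i)) g (∧-zeroˡ (f (n ∸ i))) i)))
                                      (⨁shift-reindex e (λ i r → g i ∧ f r) n)) ⟩
    ([1+q^ e ]* (g ∗ f)) n ∎)
    where open ≡-Reasoning

  poch-∗ : ∀ α β c g f → poch α β c (g ∗ f) ≐ poch α β c g ∗ f
  poch-∗ α β zero    g f n = refl
  poch-∗ α β (suc c) g f n = trans ([1+q^]-cong α (poch-∗ (α + β) β c g f) n) ([1+q^]-∗ α (poch (α + β) β c g) f n)

  poch-as-∗ : ∀ α β c f → poch α β c f ≐ poch α β c 1ₛ ∗ f
  poch-as-∗ α β c f n = trans (poch-cong α β c (λ m → sym (1ₛ-∗ f m)) n) (poch-∗ α β c 1ₛ f n)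

module Pentagonal where

  open Series
  open import Data.Bool using (Bool; true; false; _xor_)
  open import Data.Bool.Properties using (xor-identityʳ)
  open import Data.Bool.Solver using (module xor-∧-Solver)
  open import Data.Nat using (ℕ; zero; suc; _+_; _*_; _≤_; _<_; z≤n; s≤s; >-nonZero)
  open import Data.Nat.Properties
  open import Data.Nat.Tactic.RingSolver using (solve-∀)
  open import Data.Product using (Σ; _×_; _,_)
  open import Data.Sum using (_⊎_; inj₁; inj₂)
  open import Relation.Binary.PropositionalEquality
  open xor-∧-Solver using (solve; _:+_; _:=_)

  triangular : ℕ → ℕ
  triangular zero    = 0
  triangular (suc k) = suc k + triangular k

  -- the generalized pentagonal numbers k(3k+1)/2 and (k+1)(3k+2)/2
  data Pentagonal : ℕ → Set where
    plus  : ∀ k → Pentagonal (k * k + triangular k)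
    minus : ∀ k → Pentagonal (suc k * suc k + triangular k)

  PentagonalMultiple : ℕ → ℕ → Set
  PentagonalMultiple d x = Σ ℕ λ y → x ≡ d * y × Pentagonal y

  module Euler (d : ℕ) (1≤d : 1 ≤ d) where

    -- M m j agrees with (q^d; q^d)_m below degree d (j + 1), while M m m is a sum of monomials q^(d y), y pentagonal.
    M : ℕ → ℕ → Series
    M zero    j = 1ₛ
    M (suc m) j = [1+q^ (d * suc m) ]* M m j ⊕ q^ (d * (j * suc m + triangular (suc m)))

    M-shift-index : ∀ m j → M m j ≐ [1+q^ (d * suc j) ]* M m (suc j) ⊕ q^ (d * (suc m * suc j + triangular m))
    M-shift-index zero    j n = sym (begin
      (1ₛ n xor shift (d * suc j) 1ₛ n) xor (q^ (d * (1 * suc j + 0))) n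
        ≡⟨ cong ((1ₛ n xor shift (d * suc j) 1ₛ n) xor_) (shift-exponent 1ₛ (exponent d j) n) ⟩
      (1ₛ n xor (q^ (d * suc j)) n) xor (q^ (d * suc j)) n
        ≡⟨ solve 2 (λ x y → (x :+ y) :+ y := x) refl (1ₛ n) ((q^ (d * suc j)) n) ⟩
      1ₛ n ∎)
      where
      open ≡-Reasoning
      exponent : ∀ d j → d * (1 * suc j + 0) ≡ d * suc j
      exponent = solve-∀
    M-shift-index (suc m) j n = trans lhs (sym rhs)
      where
      open ≡-Reasoning
      a = d * suc m
      b = d * suc j
      A = d * (suc m * suc j + triangular m)
      C = d * (suc j * suc m + triangular (suc m))
      E = d * (suc (suc m) * suc j + triangular (suc m))
      Z = [1+q^ b ]* [1+q^ a ]* M m (suc j)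
      A≡ : ∀ d j m t → d * (j * suc m + (suc m + t)) ≡ d * (suc m * suc j + t)
      A≡ = solve-∀
      C≡ : ∀ d j m t → d * (suc m * suc j + t) + d * suc m ≡ d * (suc j * suc m + (suc m + t))
      C≡ = solve-∀
      E≡ : ∀ d j m t → d * (suc j * suc m + (suc m + t)) + d * suc j ≡ d * (suc (suc m) * suc j + (suc m + t))
      E≡ = solve-∀
      lhs : M (suc m) j n ≡ Z n xor (q^ C) n
      lhs = begin
        ([1+q^ a ]* M m j) n xor (q^ (d * (j * suc m + triangular (suc m)))) n
          ≡⟨ cong₂ _xor_ ([1+q^]-cong a (M-shift-index m j) n) (shift-exponent 1ₛ (A≡ d j m (triangular m)) n) ⟩
        ([1+q^ a ]* ([1+q^ b ]* M m (suc j) ⊕ q^ A)) n xor (q^ A) n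
          ≡⟨ cong (_xor (q^ A) n) (trans ([1+q^]-⊕ a ([1+q^ b ]* M m (suc j)) (q^ A) n)
               (cong₂ _xor_ ([1+q^]-comm a b (M m (suc j)) n)
                            (trans ([1+q^]-monomial a A n) (cong ((q^ A) n xor_) (shift-exponent 1ₛ (C≡ d j m (triangular m)) n))))) ⟩
        (Z n xor ((q^ A) n xor (q^ C) n)) xor (q^ A) n
          ≡⟨ solve 3 (λ z x y → (z :+ (x :+ y)) :+ x := z :+ y) refl (Z n) ((q^ A) n) ((q^ C) n) ⟩
        Z n xor (q^ C) n ∎
      rhs : ([1+q^ b ]* M (suc m) (suc j) ⊕ q^ E) n ≡ Z n xor (q^ C) n
      rhs = begin
        ([1+q^ b ]* ([1+q^ a ]* M m (suc j) ⊕ q^ C)) n xor (q^ E) n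
          ≡⟨ cong (_xor (q^ E) n) (trans ([1+q^]-⊕ b ([1+q^ a ]* M m (suc j)) (q^ C) n)
               (cong (Z n xor_) (trans ([1+q^]-monomial b C n) (cong ((q^ C) n xor_) (shift-exponent 1ₛ (E≡ d j m (triangular m)) n))))) ⟩
        (Z n xor ((q^ C) n xor (q^ E) n)) xor (q^ E) n
          ≡⟨ solve 3 (λ z x y → (z :+ (x :+ y)) :+ y := z :+ x) refl (Z n) ((q^ C) n) ((q^ E) n) ⟩
        Z n xor (q^ C) n ∎

    M-diagonal-step : ∀ k n → M (suc k) (suc k) n ≡
      M k k n xor ((q^ (d * (suc k * suc k + triangular k))) n xor (q^ (d * (suc k * suc k + triangular (suc k)))) n)
    M-diagonal-step k n rewrite M-shift-index k k n =
      solve 3 (λ z x y → z :+ y := (z :+ x) :+ (x :+ y)) refl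
        (([1+q^ (d * suc k) ]* M k (suc k)) n) ((q^ (d * (suc k * suc k + triangular k))) n) ((q^ (d * (suc k * suc k + triangular (suc k)))) n)

    M-diagonal-support : ∀ k n → M k k n ≡ true → PentagonalMultiple d n
    M-diagonal-support zero    zero _ = 0 , sym (*-zeroʳ d) , plus 0
    M-diagonal-support (suc k) n h with xor-true (trans (sym (M-diagonal-step k n)) h)
      where
      xor-true : ∀ {a b c} → a xor (b xor c) ≡ true → a ≡ true ⊎ b ≡ true ⊎ c ≡ true
      xor-true {true}                _ = inj₁ refl
      xor-true {false} {true}        _ = inj₂ (inj₁ refl)
      xor-true {false} {false} {true} _ = inj₂ (inj₂ refl)
    ... | inj₁ h₀        = M-diagonal-support k n h₀
    ... | inj₂ (inj₁ h₋) = _ , q^-coefficient _ n h₋ , minus k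
    ... | inj₂ (inj₂ h₊) = _ , q^-coefficient _ n h₊ , plus (suc k)

    M-≈-poch : ∀ m j N → N < suc j → M m j ≈[ N ] poch d d m 1ₛ
    M-≈-poch zero    j N _      = ≈-refl N
    M-≈-poch (suc m) j N N<1+j n n≤N = begin
      ([1+q^ (d * suc m) ]* M m j) n xor (q^ (d * (j * suc m + triangular (suc m)))) n
        ≡⟨ cong (([1+q^ (d * suc m) ]* M m j) n xor_) (shift-below _ 1ₛ (≤-<-trans n≤N N<high)) ⟩
      ([1+q^ (d * suc m) ]* M m j) n xor false
        ≡⟨ xor-identityʳ _ ⟩
      ([1+q^ (d * suc m) ]* M m j) n
        ≡⟨ [1+q^]-≈ (d * suc m) N (M-≈-poch m j N N<1+j) n n≤N ⟩
      ([1+q^ (d * suc m) ]* poch d d m 1ₛ) n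
        ≡⟨ [1+q^]-exponent (poch d d m 1ₛ) (*-suc d m) n ⟩
      ([1+q^ (d + d * m) ]* poch d d m 1ₛ) n
        ≡⟨ poch-snoc d d m 1ₛ n ⟨
      poch d d (suc m) 1ₛ n ∎
      where
      open ≡-Reasoning
      N<high : N < d * (j * suc m + triangular (suc m))
      N<high = <-≤-trans N<1+j (≤-trans (≤-reflexive (+-comm 1 j))
                 (≤-trans (+-mono-≤ (m≤m*n j (suc m)) (s≤s z≤n)) (m≤n*m _ d {{>-nonZero 1≤d}})))

    poch-support : ∀ c n → n ≤ c → poch d d c 1ₛ n ≡ true → PentagonalMultiple d n
    poch-support c n n≤c h = M-diagonal-support c n (trans (M-≈-poch c c n (s≤s n≤c) n ≤-refl) h)

module PartitionSums where

  open XorSums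
  open Series
  open import Defs using (partsUpTo)
  open import Data.Bool using (Bool; true; false; _xor_; _∧_; if_then_else_)
  open import Data.Bool.Properties using (xor-identityʳ; ∧-zeroʳ)
  open import Data.List using (List; []; _∷_; _++_; map; replicate; foldr; applyUpTo)
  open import Data.Nat using (ℕ; zero; suc; _+_; _*_; _∸_; _≤_; _<_; s≤s; _≤?_)
  open import Data.Nat.ListAction using (sum)
  open import Data.Nat.ListAction.Properties using (sum-++)
  open import Data.Nat.Properties
  open import Relation.Binary.PropositionalEquality
  open import Relation.Nullary using (Dec; yes; no; ¬_)
  open import Relation.Nullary.Decidable using (⌊_⌋; isYes≗does; dec-true; dec-false)

  isYes-true : {A : Set} (a? : Dec A) → A → ⌊ a? ⌋ ≡ true
  isYes-true a? a = trans (isYes≗does a?) (dec-true a? a)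

  isYes-false : {A : Set} (a? : Dec A) → ¬ A → ⌊ a? ⌋ ≡ false
  isYes-false a? ¬a = trans (isYes≗does a?) (dec-false a? ¬a)

  isYes-⇔ : {A B : Set} (a? : Dec A) (b? : Dec B) → (A → B) → (B → A) → ⌊ a? ⌋ ≡ ⌊ b? ⌋
  isYes-⇔ a? (yes b) A→B B→A = isYes-true a? (B→A b)
  isYes-⇔ a? (no ¬b) A→B B→A = isYes-false a? (λ a → ¬b (A→B a))

  ⨁parts : (ℕ → Bool) → ℕ → ℕ → (List ℕ → Bool) → Bool
  ⨁parts P n k H = ⨁∈ (partsUpTo P n k) H

  ⨁parts-cong : ∀ P n k {H H′} → (∀ γ → H γ ≡ H′ γ) → ⨁parts P n k H ≡ ⨁parts P n k H′
  ⨁parts-cong P n k = ⨁∈-cong (partsUpTo P n k)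

  ⨁parts-false : ∀ P n k {H} → (∀ γ → H γ ≡ false) → ⨁parts P n k H ≡ false
  ⨁parts-false P n k = ⨁∈-false (partsUpTo P n k)

  ⨁parts-xor : ∀ P n k H H′ → ⨁parts P n k (λ γ → H γ xor H′ γ) ≡ ⨁parts P n k H xor ⨁parts P n k H′
  ⨁parts-xor P n k = ⨁∈-xor (partsUpTo P n k)

  ⨁parts-no-parts : ∀ P n H → ⨁parts P n 0 H ≡ 1ₛ n ∧ H []
  ⨁parts-no-parts P zero    H = xor-identityʳ (H [])
  ⨁parts-no-parts P (suc n) H = refl

  multiplicityTerm : (ℕ → Bool) → ℕ → ℕ → (List ℕ → Bool) → ℕ → Bool
  multiplicityTerm P n k H c =
    if ⌊ suc c * suc k ≤? n ⌋ ∧ P (suc k)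
    then ⨁parts P (n ∸ suc c * suc k) k (λ γ → H (replicate (suc c) (suc k) ++ γ))
    else false

  ⨁∈-if-map : ∀ b c x (L : List (List ℕ)) (H : List ℕ → Bool) →
    ⨁∈ (if b then map (replicate c x ++_) L else []) H ≡ (if b then ⨁[ γ ∈ L ] H (replicate c x ++ γ) else false)
  ⨁∈-if-map true  c x L H = ⨁∈-map _ L H
  ⨁∈-if-map false c x L H = refl

  ⨁∈-blocks : (L A : List (List ℕ)) (F : ℕ → List (List ℕ)) (n : ℕ) (H : List ℕ → Bool) →
    L ≡ A ++ foldr _++_ [] (map F (applyUpTo suc n)) → ⨁∈ L H ≡ ⨁∈ A H xor ⨁[ c < n ] ⨁∈ (F (suc c)) H
  ⨁∈-blocks _ A F n H refl = trans (⨁∈-++ A _ H)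
    (cong (⨁∈ A H xor_) (trans (⨁∈-concatMap F (applyUpTo suc n) H) (⨁∈-applyUpTo suc n (λ c → ⨁∈ (F c) H))))

  ⨁parts-unfold : ∀ P n k H → ⨁parts P n (suc k) H ≡ ⨁parts P n k H xor ⨁< n (multiplicityTerm P n k H)
  ⨁parts-unfold P zero    k H = trans (⨁∈-blocks (partsUpTo P 0 (suc k)) (map ([] ++_) (partsUpTo P 0 k)) (λ _ → []) 0 H refl)
    (cong (_xor false) (⨁∈-map _ (partsUpTo P 0 k) H))
  ⨁parts-unfold P (suc n) k H = trans (⨁∈-blocks (partsUpTo P (suc n) (suc k)) (map ([] ++_) (partsUpTo P (suc n) k)) _ (suc n) H refl)
    (cong₂ _xor_ (⨁∈-map _ (partsUpTo P (suc n) k) H)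
      (⨁<-cong (suc n) (λ c _ → ⨁∈-if-map (⌊ suc c * suc k ≤? suc n ⌋ ∧ P (suc k)) (suc c) (suc k) (partsUpTo P (suc n ∸ suc c * suc k) k) H)))

  multiplicityTerm-large : ∀ P n k H c → n < suc c * suc k → multiplicityTerm P n k H c ≡ false
  multiplicityTerm-large P n k H c n<
    rewrite isYes-false (suc c * suc k ≤? n) (<⇒≱ n<) = refl

  multiplicityTerm-excluded : ∀ P n k H c → P (suc k) ≡ false → multiplicityTerm P n k H c ≡ false
  multiplicityTerm-excluded P n k H c P≡false rewrite P≡false | ∧-zeroʳ ⌊ suc c * suc k ≤? n ⌋ = refl

  multiplicityTerm-shift : ∀ P k H m c →
    multiplicityTerm P (suc k + m) k H (suc c) ≡ multiplicityTerm P m k (λ γ → H (suc k ∷ γ)) c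
  multiplicityTerm-shift P k H m c = cong₂ (λ b x → if b ∧ P (suc k) then x else false)
    (isYes-⇔ (suc (suc c) * suc k ≤? suc k + m) (suc c * suc k ≤? m) (+-cancelˡ-≤ (suc k) _ _) (+-monoʳ-≤ (suc k)))
    (cong (λ r → ⨁parts P r k (λ γ → H (suc k ∷ replicate (suc c) (suc k) ++ γ))) ([m+n]∸[m+o]≡n∸o (suc k) m (suc c * suc k)))

  -- Either suc k is not a part, or removing one part suc k leaves a partition of n ∸ suc k.
  ⨁parts-rec : ∀ P n k H → ⨁parts P n (suc k) H ≡
    ⨁parts P n k H xor (P (suc k) ∧ shift (suc k) (λ m → ⨁parts P m (suc k) (λ γ → H (suc k ∷ γ))) n)
  ⨁parts-rec P n k H = trans (⨁parts-unfold P n k H) (cong (⨁parts P n k H xor_) (largest (P (suc k)) refl))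
    where
    H′ : List ℕ → Bool
    H′ γ = H (suc k ∷ γ)
    largest : ∀ b → P (suc k) ≡ b → ⨁< n (multiplicityTerm P n k H) ≡ b ∧ shift (suc k) (λ m → ⨁parts P m (suc k) H′) n
    largest false P≡false = ⨁<-false n (λ c _ → multiplicityTerm-excluded P n k H c P≡false)
    largest true  P≡true  = sym (shift-unique (suc k) (λ m → ⨁parts P m (suc k) H′) (λ n → ⨁< n (multiplicityTerm P n k H)) low high n)
      where
      low : ∀ n → n < suc k → ⨁< n (multiplicityTerm P n k H) ≡ false
      low n n<1+k = ⨁<-false n (λ c _ → multiplicityTerm-large P n k H c (<-≤-trans n<1+k (m≤m+n (suc k) (c * suc k))))
      high : ∀ m → ⨁< (suc k + m) (multiplicityTerm P (suc k + m) k H) ≡ ⨁parts P m (suc k) H′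
      high m = begin
        multiplicityTerm P (suc k + m) k H 0 xor ⨁< (k + m) (λ c → multiplicityTerm P (suc k + m) k H (suc c))
          ≡⟨ cong₂ _xor_ once (⨁<-vanishing-tail m (k + m) _ (m≤n+m m k)
               (λ c m≤c _ → multiplicityTerm-large P (suc k + m) k H (suc c) (+-monoʳ-< (suc k) (≤-trans (s≤s m≤c) (m≤m*n (suc c) (suc k)))))) ⟩
        ⨁parts P m k H′ xor ⨁< m (λ c → multiplicityTerm P (suc k + m) k H (suc c))
          ≡⟨ cong (⨁parts P m k H′ xor_) (⨁<-cong m (λ c _ → multiplicityTerm-shift P k H m c)) ⟩
        ⨁parts P m k H′ xor ⨁< m (multiplicityTerm P m k H′)
          ≡⟨ ⨁parts-unfold P m k H′ ⟨
        ⨁parts P m (suc k) H′ ∎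
        where
        open ≡-Reasoning
        once : multiplicityTerm P (suc k + m) k H 0 ≡ ⨁parts P m k H′
        once = cong₂ (λ b x → if b then x else false)
          (cong₂ _∧_ (isYes-true (1 * suc k ≤? suc k + m) (subst (_≤ suc k + m) (sym (*-identityˡ (suc k))) (m≤m+n (suc k) m))) P≡true)
          (cong (λ r → ⨁parts P r k H′) (trans (cong (suc k + m ∸_) (*-identityˡ (suc k))) (m+n∸m≡n (suc k) m)))

  sum-replicate : ∀ c x → sum (replicate c x) ≡ c * x
  sum-replicate zero    x = refl
  sum-replicate (suc c) x = cong (x +_) (sum-replicate c x)

  ⨁parts-sum : ∀ P k n (F : ℕ → List ℕ → Bool) → ⨁parts P n k (λ γ → F (sum γ) γ) ≡ ⨁parts P n k (F n)
  ⨁parts-sum P zero    zero    F = refl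
  ⨁parts-sum P zero    (suc n) F = refl
  ⨁parts-sum P (suc k) n       F = begin
    ⨁parts P n (suc k) (λ γ → F (sum γ) γ)
      ≡⟨ ⨁parts-unfold P n k _ ⟩
    ⨁parts P n k (λ γ → F (sum γ) γ) xor ⨁< n (multiplicityTerm P n k (λ γ → F (sum γ) γ))
      ≡⟨ cong₂ _xor_ (⨁parts-sum P k n F) (⨁<-cong n (λ c _ → term c)) ⟩
    ⨁parts P n k (F n) xor ⨁< n (multiplicityTerm P n k (F n))
      ≡⟨ ⨁parts-unfold P n k (F n) ⟨
    ⨁parts P n (suc k) (F n) ∎
    where
    open ≡-Reasoning
    term : ∀ c → multiplicityTerm P n k (λ γ → F (sum γ) γ) c ≡ multiplicityTerm P n k (F n) c
    term c with suc c * suc k ≤? n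
    ... | no  _ = refl
    ... | yes X≤n = cong (λ x → if P (suc k) then x else false) (begin
      ⨁parts P (n ∸ X) k (λ γ → F (sum (R ++ γ)) (R ++ γ))
        ≡⟨ ⨁parts-cong P (n ∸ X) k (λ γ → cong (λ s → F s (R ++ γ)) (trans (sum-++ R γ) (cong (_+ sum γ) (sum-replicate (suc c) (suc k))))) ⟩
      ⨁parts P (n ∸ X) k (λ γ → F (X + sum γ) (R ++ γ))
        ≡⟨ ⨁parts-sum P k (n ∸ X) (λ s γ → F (X + s) (R ++ γ)) ⟩
      ⨁parts P (n ∸ X) k (λ γ → F (X + (n ∸ X)) (R ++ γ))
        ≡⟨ ⨁parts-cong P (n ∸ X) k (λ γ → cong (λ s → F s (R ++ γ)) (m+[n∸m]≡n X≤n)) ⟩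
      ⨁parts P (n ∸ X) k (λ γ → F n (R ++ γ)) ∎)
      where
      X = suc c * suc k
      R = replicate (suc c) (suc k)

  ⨁parts-bound : ∀ P n K H → n ≤ K → ⨁parts P n K H ≡ ⨁parts P n n H
  ⨁parts-bound P n K H n≤K = trans (cong (λ K → ⨁parts P n K H) (sym (m+[n∸m]≡n n≤K))) (beyond (K ∸ n))
    where
    beyond : ∀ d → ⨁parts P n (n + d) H ≡ ⨁parts P n n H
    beyond zero    = cong (λ K → ⨁parts P n K H) (+-identityʳ n)
    beyond (suc d) = begin
      ⨁parts P n (n + suc d) H
        ≡⟨ cong (λ K → ⨁parts P n K H) (+-suc n d) ⟩
      ⨁parts P n (suc (n + d)) H
        ≡⟨ ⨁parts-rec P n (n + d) H ⟩
      ⨁parts P n (n + d) H xor (P (suc (n + d)) ∧ shift (suc (n + d)) _ n)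
        ≡⟨ cong (λ x → ⨁parts P n (n + d) H xor (P (suc (n + d)) ∧ x)) (shift-below (suc (n + d)) _ (s≤s (m≤m+n n d))) ⟩
      ⨁parts P n (n + d) H xor (P (suc (n + d)) ∧ false)
        ≡⟨ cong (⨁parts P n (n + d) H xor_) (∧-zeroʳ (P (suc (n + d)))) ⟩
      ⨁parts P n (n + d) H xor false
        ≡⟨ xor-identityʳ _ ⟩
      ⨁parts P n (n + d) H
        ≡⟨ beyond d ⟩
      ⨁parts P n n H ∎
      where open ≡-Reasoning

module PartitionTransform where

  open import Defs using (partsUpTo)
  open XorSums
  open Series
  open PartitionSums
  open import Data.Bool using (Bool; true; false; _xor_; _∧_)
  open import Data.Bool.Properties using (xor-identityʳ; ∧-zeroʳ)
  open import Data.Bool.Solver using (module xor-∧-Solver)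
  open import Data.List using (length)
  open import Data.Nat using (ℕ; zero; suc; _+_; _*_; _≤_; s≤s; z≤n)
  open import Data.Nat.Properties
  open import Relation.Binary.PropositionalEquality
  open xor-∧-Solver using (solve; _:+_; _:*_; _:=_)

  -- 𝒫 P k Φ = Σ_γ q^|γ| Φ_ℓ(γ), over the partitions γ into parts ≤ k satisfying P; ℓ(γ) is the number of parts
  𝒫 : (ℕ → Bool) → ℕ → (ℕ → Series) → Series
  𝒫 P k Φ = ⨁shift (λ g r → ⨁parts P g k (λ γ → Φ (length γ) r))

  𝒫-cong : ∀ P k {Φ Ψ} → (∀ j → Φ j ≐ Ψ j) → 𝒫 P k Φ ≐ 𝒫 P k Ψ
  𝒫-cong P k Φ≐Ψ = ⨁shift-cong (λ g r → ⨁parts-cong P g k (λ γ → Φ≐Ψ (length γ) r))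

  𝒫-≈ : ∀ P k {Φ Ψ} N → (∀ j → Φ j ≈[ N ] Ψ j) → 𝒫 P k Φ ≈[ N ] 𝒫 P k Ψ
  𝒫-≈ P k N Φ≈Ψ = ⨁shift-≈ N (λ g r r≤N → ⨁parts-cong P g k (λ γ → Φ≈Ψ (length γ) r r≤N))

  𝒫-vanish : ∀ P k {Φ} N → (∀ j → Φ j ≈[ N ] 0ₛ) → 𝒫 P k Φ ≈[ N ] 0ₛ
  𝒫-vanish P k N Φ≈0 = ⨁shift-vanish N (λ g r r≤N → ⨁parts-false P g k (λ γ → Φ≈0 (length γ) r r≤N))

  𝒫-⊕ : ∀ P k Φ Ψ → 𝒫 P k (λ j → Φ j ⊕ Ψ j) ≐ 𝒫 P k Φ ⊕ 𝒫 P k Ψ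
  𝒫-⊕ P k Φ Ψ n = trans (⨁shift-cong (λ g r → ⨁parts-xor P g k (λ γ → Φ (length γ) r) (λ γ → Ψ (length γ) r)) n)
    (⨁shift-⊕ (λ g r → ⨁parts P g k (λ γ → Φ (length γ) r)) (λ g r → ⨁parts P g k (λ γ → Ψ (length γ) r)) n)

  𝒫-shift : ∀ P k c Φ → 𝒫 P k (λ j → shift c (Φ j)) ≐ shift c (𝒫 P k Φ)
  𝒫-shift P k c Φ n = trans (⨁shift-cong (λ g r → ⨁∈-shift (partsUpTo P g k) c (λ γ → Φ (length γ)) r) n)
    (⨁shift-shift c (λ g r → ⨁parts P g k (λ γ → Φ (length γ) r)) n)

  𝒫-no-parts : ∀ P Φ → 𝒫 P 0 Φ ≐ Φ 0
  𝒫-no-parts P Φ n = trans (⨁shift-cong (λ g r → ⨁parts-no-parts P g (λ γ → Φ (length γ) r)) n) (1ₛ-∗ (Φ 0) n)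

  𝒫-rec : ∀ P k Φ → 𝒫 P (suc k) Φ ≐ 𝒫 P k Φ ⊕ (λ n → P (suc k) ∧ shift (suc k) (𝒫 P (suc k) (λ j → Φ (suc j))) n)
  𝒫-rec P k Φ n = begin
    𝒫 P (suc k) Φ n
      ≡⟨ ⨁shift-cong (λ g r → ⨁parts-rec P g k (λ γ → Φ (length γ) r)) n ⟩
    ⨁shift (λ g r → ⨁parts P g k (λ γ → Φ (length γ) r) xor (P (suc k) ∧ shift (suc k) (λ m → B m r) g)) n
      ≡⟨ ⨁shift-⊕ (λ g r → ⨁parts P g k (λ γ → Φ (length γ) r)) (λ g r → P (suc k) ∧ shift (suc k) (λ m → B m r) g) n ⟩
    𝒫 P k Φ n xor ⨁shift (λ g r → P (suc k) ∧ shift (suc k) (λ m → B m r) g) n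
      ≡⟨ cong (𝒫 P k Φ n xor_) (trans (⨁shift-∧ (P (suc k)) (λ g r → shift (suc k) (λ m → B m r) g) n)
           (cong (P (suc k) ∧_) (⨁shift-reindex (suc k) B n))) ⟩
    𝒫 P k Φ n xor (P (suc k) ∧ shift (suc k) (𝒫 P (suc k) (λ j → Φ (suc j))) n) ∎
    where
    open ≡-Reasoning
    B : ℕ → Series
    B m r = ⨁parts P m (suc k) (λ γ → Φ (suc (length γ)) r)

  𝒫-excluded : ∀ P k Φ → P (suc k) ≡ false → 𝒫 P (suc k) Φ ≐ 𝒫 P k Φ
  𝒫-excluded P k Φ P≡false n rewrite 𝒫-rec P k Φ n | P≡false = xor-identityʳ (𝒫 P k Φ n)

  𝒫-included : ∀ P k Φ → P (suc k) ≡ true → 𝒫 P (suc k) Φ ≐ 𝒫 P k Φ ⊕ shift (suc k) (𝒫 P (suc k) (λ j → Φ (suc j)))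
  𝒫-included P k Φ P≡true n rewrite 𝒫-rec P k Φ n | P≡true = refl

  𝒫-empty-only : ∀ P k Φ N → (∀ j → Φ (suc j) ≈[ N ] 0ₛ) → 𝒫 P k Φ ≈[ N ] Φ 0
  𝒫-empty-only P zero    Φ N Φ≈0 = ≐⇒≈ N (𝒫-no-parts P Φ)
  𝒫-empty-only P (suc k) Φ N Φ≈0 n n≤N = begin
    𝒫 P (suc k) Φ n
      ≡⟨ 𝒫-rec P k Φ n ⟩
    𝒫 P k Φ n xor (P (suc k) ∧ shift (suc k) (𝒫 P (suc k) (λ j → Φ (suc j))) n)
      ≡⟨ cong (λ x → 𝒫 P k Φ n xor (P (suc k) ∧ x))
           (trans (shift-≈ (suc k) N (𝒫-vanish P (suc k) N Φ≈0) n n≤N) (shift-0ₛ (suc k) n)) ⟩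
    𝒫 P k Φ n xor (P (suc k) ∧ false)
      ≡⟨ trans (cong (𝒫 P k Φ n xor_) (∧-zeroʳ (P (suc k)))) (xor-identityʳ (𝒫 P k Φ n)) ⟩
    𝒫 P k Φ n
      ≡⟨ 𝒫-empty-only P k Φ N Φ≈0 n n≤N ⟩
    Φ 0 n ∎
    where open ≡-Reasoning

  -- Raising each of the ℓ parts of a partition by 4 multiplies its contribution by q^(4 ℓ).
  raised : (ℕ → Series) → ℕ → Series
  raised Φ j = shift (4 * j) (Φ j)

  raised-suc : ∀ Φ j → raised Φ (suc j) ≐ shift 4 (raised (λ i → Φ (suc i)) j)
  raised-suc Φ j n = trans (shift-exponent (Φ (suc j)) (*-suc 4 j) n) (sym (shift-+ 4 (4 * j) (Φ (suc j)) n))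

  -- P is a residue class modulo 4 with least element a.
  module ResidueClass (P : ℕ → Bool) (a : ℕ)
    (periodic : ∀ k → P (suc (k + 4)) ≡ P (suc k))
    (base : ∀ Φ → 𝒫 P 4 Φ ≐ Φ 0 ⊕ shift a (𝒫 P 4 (λ j → Φ (suc j)))) where

    -- A partition into parts ≤ k + 4 either contains the part a, or arises by raising the parts of one with parts ≤ k.
    𝒫-periodic : ∀ k Φ → 𝒫 P (k + 4) Φ ≐ 𝒫 P k (raised Φ) ⊕ shift a (𝒫 P (k + 4) (λ j → Φ (suc j)))
    𝒫-periodic zero    Φ n = trans (base Φ n) (cong (_xor shift a (𝒫 P 4 (λ j → Φ (suc j))) n) (sym (𝒫-no-parts P (raised Φ) n)))
    𝒫-periodic (suc k) Φ n = xor≡false⇒≡ (shift-fixpoint-vanishes D (λ Φ j → Φ (suc j)) e (P e) (s≤s z≤n) D-step Φ n)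
      where
      e = suc (k + 4)
      -- The discrepancy D satisfies D Φ = P e · q^e D (Φ ∘ suc), so it vanishes.
      D : (ℕ → Series) → Series
      D Φ = 𝒫 P e Φ ⊕ (𝒫 P (suc k) (raised Φ) ⊕ shift a (𝒫 P e (λ j → Φ (suc j))))
      D-step : ∀ Φ → D Φ ≐ (λ n → P e ∧ shift e (D (λ j → Φ (suc j))) n)
      D-step Φ n = begin
        D Φ n
          ≡⟨ cong₂ _xor_ t₁ (cong₂ _xor_ t₂ t₃) ⟩
        ((L xor S) xor (P e ∧ X)) xor ((L xor (P e ∧ Y)) xor (S xor (P e ∧ Z)))
          ≡⟨ solve 6 (λ b L S X Y Z → ((L :+ S) :+ (b :* X)) :+ ((L :+ (b :* Y)) :+ (S :+ (b :* Z))) := b :* (X :+ (Y :+ Z)))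
               refl (P e) L S X Y Z ⟩
        P e ∧ (X xor (Y xor Z))
          ≡⟨ cong (P e ∧_) (sym (trans (shift-⊕ e _ _ n) (cong (X xor_) (shift-⊕ e _ _ n)))) ⟩
        P e ∧ shift e (D Φ′) n ∎
        where
        open ≡-Reasoning
        Φ′ = λ j → Φ (suc j)
        Φ″ = λ j → Φ (suc (suc j))
        L = 𝒫 P k (raised Φ) n
        S = shift a (𝒫 P (k + 4) Φ′) n
        X = shift e (𝒫 P e Φ′) n
        Y = shift e (𝒫 P (suc k) (raised Φ′)) n
        Z = shift e (shift a (𝒫 P e Φ″)) n
        t₁ : 𝒫 P e Φ n ≡ (L xor S) xor (P e ∧ X)
        t₁ = trans (𝒫-rec P (k + 4) Φ n) (cong (_xor (P e ∧ X)) (𝒫-periodic k Φ n))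
        t₂ : 𝒫 P (suc k) (raised Φ) n ≡ L xor (P e ∧ Y)
        t₂ = trans (𝒫-rec P k (raised Φ) n) (cong (L xor_) (cong₂ _∧_ (sym (periodic k))
               (trans (shift-cong (suc k) (λ m → trans (𝒫-cong P (suc k) (raised-suc Φ) m) (𝒫-shift P (suc k) 4 (raised Φ′) m)) n)
                      (shift-+ (suc k) 4 _ n))))
        t₃ : shift a (𝒫 P e Φ′) n ≡ S xor (P e ∧ Z)
        t₃ = trans (shift-cong a (𝒫-rec P (k + 4) Φ′) n) (trans (shift-⊕ a _ _ n) (cong (S xor_)
               (trans (shift-map a (P e ∧_) (shift e (𝒫 P e Φ″)) (∧-zeroʳ (P e)) n) (cong (P e ∧_) (shift-comm a e _ n)))))

module CopartitionSeries where

  open import Defs using (admissible)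
  open XorSums
  open Series
  open PartitionSums
  open PartitionTransform
  open import Data.Bool using (Bool; false; _xor_; _∧_)
  open import Data.Bool.Properties using (xor-identityʳ; ∧-zeroʳ)
  open import Data.Bool.Solver using (module xor-∧-Solver)
  open import Data.Nat using (ℕ; zero; suc; _+_; _*_; _≤_; _<_; s≤s; z≤n)
  open import Data.Nat.Divisibility using (_∣?_; ∣m+n∣m⇒∣n; ∣m∣n⇒∣m+n; ∣-refl)
  open import Data.Nat.Properties
  open import Data.Nat.Tactic.RingSolver using (solve-∀)
  open import Relation.Binary.PropositionalEquality
  open import Relation.Nullary.Decidable using (⌊_⌋)
  open xor-∧-Solver using (solve; _:+_; _:=_)

  P₃ P₁ : ℕ → Bool
  P₃ = admissible 3 4
  P₁ = admissible 1 4

  4∣?-4+ : ∀ k → ⌊ 4 ∣? (4 + k) ⌋ ≡ ⌊ 4 ∣? k ⌋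
  4∣?-4+ k = isYes-⇔ (4 ∣? (4 + k)) (4 ∣? k) (λ 4∣4+k → ∣m+n∣m⇒∣n 4∣4+k ∣-refl) (∣m∣n⇒∣m+n ∣-refl)

  P₁-periodic : ∀ k → P₁ (suc (k + 4)) ≡ P₁ (suc k)
  P₁-periodic k rewrite +-comm k 4 = 4∣?-4+ k

  P₃-periodic : ∀ k → P₃ (suc (k + 4)) ≡ P₃ (suc k)
  P₃-periodic k rewrite +-comm k 4 = periodic k
    where
    periodic : ∀ k → P₃ (suc (4 + k)) ≡ P₃ (suc k)
    periodic zero          = refl
    periodic (suc zero)    = refl
    periodic (suc (suc k)) = 4∣?-4+ k

  P₃-base : ∀ Φ → 𝒫 P₃ 4 Φ ≐ Φ 0 ⊕ shift 3 (𝒫 P₃ 4 (λ j → Φ (suc j)))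
  P₃-base Φ n = trans (𝒫-excluded P₃ 3 Φ refl n) (trans (𝒫-included P₃ 2 Φ refl n)
    (cong₂ _xor_ (trans (𝒫-excluded P₃ 1 Φ refl n) (trans (𝒫-excluded P₃ 0 Φ refl n) (𝒫-no-parts P₃ Φ n)))
      (shift-cong 3 (λ m → sym (𝒫-excluded P₃ 3 (λ j → Φ (suc j)) refl m)) n)))

  P₁-base : ∀ Φ → 𝒫 P₁ 4 Φ ≐ Φ 0 ⊕ shift 1 (𝒫 P₁ 4 (λ j → Φ (suc j)))
  P₁-base Φ n = trans (𝒫-excluded P₁ 3 Φ refl n) (trans (𝒫-excluded P₁ 2 Φ refl n) (trans (𝒫-excluded P₁ 1 Φ refl n)
    (trans (𝒫-included P₁ 0 Φ refl n) (cong₂ _xor_ (𝒫-no-parts P₁ Φ n)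
      (shift-cong 1 (λ m → sym (trans (𝒫-excluded P₁ 3 Φ′ refl m) (trans (𝒫-excluded P₁ 2 Φ′ refl m) (𝒫-excluded P₁ 1 Φ′ refl m)))) n)))))
    where
    Φ′ = λ j → Φ (suc j)

  module R₃ = ResidueClass P₃ 3 P₃-periodic P₃-base
  module R₁ = ResidueClass P₁ 1 P₁-periodic P₁-base

  downward-induction : ∀ (B : ℕ) (Q : ℕ → Set) → (∀ x → B ≤ x → Q x) → (∀ x → Q (suc x) → Q x) → ∀ x → Q x
  downward-induction B Q large step x = from B x (m≤m+n B x)
    where
    from : ∀ d x → B ≤ d + x → Q x
    from zero    x B≤x   = large x B≤x
    from (suc d) x B≤1+d+x = step x (from d (suc x) (subst (B ≤_) (sym (+-suc d x)) B≤1+d+x))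

  -- Parts and products are truncated at N, which is exact modulo q^(N+1).
  module Truncated (N : ℕ) where

    𝒫-stable : ∀ P d Φ → 𝒫 P (N + d) Φ ≈[ N ] 𝒫 P N Φ
    𝒫-stable P zero    Φ = ≐⇒≈ N (λ n → cong (λ k → 𝒫 P k Φ n) (+-identityʳ N))
    𝒫-stable P (suc d) Φ n n≤N = begin
      𝒫 P (N + suc d) Φ n
        ≡⟨ cong (λ k → 𝒫 P k Φ n) (+-suc N d) ⟩
      𝒫 P (suc (N + d)) Φ n
        ≡⟨ 𝒫-rec P (N + d) Φ n ⟩
      𝒫 P (N + d) Φ n xor (P (suc (N + d)) ∧ shift (suc (N + d)) (𝒫 P (suc (N + d)) (λ j → Φ (suc j))) n)
        ≡⟨ cong (λ x → 𝒫 P (N + d) Φ n xor (P (suc (N + d)) ∧ x)) (shift-below (suc (N + d)) _ (s≤s (≤-trans n≤N (m≤m+n N d)))) ⟩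
      𝒫 P (N + d) Φ n xor (P (suc (N + d)) ∧ false)
        ≡⟨ trans (cong (𝒫 P (N + d) Φ n xor_) (∧-zeroʳ (P (suc (N + d))))) (xor-identityʳ _) ⟩
      𝒫 P (N + d) Φ n
        ≡⟨ 𝒫-stable P d Φ n n≤N ⟩
      𝒫 P N Φ n ∎
      where open ≡-Reasoning

    periodic-≈ : ∀ P a → (∀ Φ → 𝒫 P (N + 4) Φ ≐ 𝒫 P N (raised Φ) ⊕ shift a (𝒫 P (N + 4) (λ j → Φ (suc j)))) →
      ∀ Φ → 𝒫 P N Φ ≈[ N ] 𝒫 P N (raised Φ) ⊕ shift a (𝒫 P N (λ j → Φ (suc j)))
    periodic-≈ P a periodic Φ = ≈-trans N (≈-sym N (𝒫-stable P 4 Φ)) (≈-trans N (≐⇒≈ N (periodic Φ))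
      (⊕-≈ N (≈-refl {𝒫 P N (raised Φ)} N) (shift-≈ a N (𝒫-stable P 4 (λ j → Φ (suc j))))))

    -- T u = Σ_σ q^(|σ| + 4 u ℓ(σ)) over the partitions σ into parts ≡ 1 (mod 4)
    T : ℕ → Series
    T u = 𝒫 P₁ N (λ l → q^ (4 * u * l))

    -- Y s r = Σ_γ q^(|γ| + 4 s ℓ(γ)) T (ℓ(γ) + r) over the partitions γ into parts ≡ 3 (mod 4)
    Y : ℕ → ℕ → Series
    Y s r = 𝒫 P₃ N (λ j → shift (4 * s * j) (T (j + r)))

    T-rec : ∀ u → T u ≈[ N ] T (suc u) ⊕ shift (1 + 4 * u) (T u)
    T-rec u = ≈-trans N (periodic-≈ P₁ 1 (R₁.𝒫-periodic N) (λ l → q^ (4 * u * l)))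
      (≐⇒≈ N (λ n → cong₂ _xor_ (raise n) (trans (shift-cong 1 remove n) (shift-+ 1 (4 * u) (T u) n))))
      where
      raise : 𝒫 P₁ N (raised (λ l → q^ (4 * u * l))) ≐ T (suc u)
      raise = 𝒫-cong P₁ N (λ l m → trans (shift-+ (4 * l) (4 * u * l) 1ₛ m) (shift-exponent 1ₛ (exponent u l) m))
        where
        exponent : ∀ u l → 4 * l + 4 * u * l ≡ 4 * suc u * l
        exponent = solve-∀
      remove : 𝒫 P₁ N (λ l → q^ (4 * u * suc l)) ≐ shift (4 * u) (T u)
      remove m = trans (𝒫-cong P₁ N (λ l m′ → trans (shift-exponent 1ₛ (exponent u l) m′) (sym (shift-+ (4 * u) (4 * u * l) 1ₛ m′))) m)
        (𝒫-shift P₁ N (4 * u) (λ l → q^ (4 * u * l)) m)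
        where
        exponent : ∀ u l → 4 * u * suc l ≡ 4 * u + 4 * u * l
        exponent = solve-∀

    Y-rec₃ : ∀ s r → Y s r ≈[ N ] Y (suc s) r ⊕ shift (3 + 4 * s) (Y s (suc r))
    Y-rec₃ s r = ≈-trans N (periodic-≈ P₃ 3 (R₃.𝒫-periodic N) Φ)
      (≐⇒≈ N (λ n → cong₂ _xor_ (raise n) (trans (shift-cong 3 remove n) (shift-+ 3 (4 * s) (Y s (suc r)) n))))
      where
      Φ : ℕ → Series
      Φ j = shift (4 * s * j) (T (j + r))
      raise : 𝒫 P₃ N (raised Φ) ≐ Y (suc s) r
      raise = 𝒫-cong P₃ N (λ j m → trans (shift-+ (4 * j) (4 * s * j) (T (j + r)) m) (shift-exponent (T (j + r)) (exponent s j) m))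
        where
        exponent : ∀ s j → 4 * j + 4 * s * j ≡ 4 * suc s * j
        exponent = solve-∀
      remove : 𝒫 P₃ N (λ j → Φ (suc j)) ≐ shift (4 * s) (Y s (suc r))
      remove m = trans (𝒫-cong P₃ N (λ j m′ → begin
          shift (4 * s * suc j) (T (suc (j + r))) m′
            ≡⟨ shift-exponent (T (suc (j + r))) (exponent s j) m′ ⟩
          shift (4 * s + 4 * s * j) (T (suc (j + r))) m′
            ≡⟨ shift-+ (4 * s) (4 * s * j) (T (suc (j + r))) m′ ⟨
          shift (4 * s) (shift (4 * s * j) (T (suc (j + r)))) m′
            ≡⟨ cong (λ t → shift (4 * s) (shift (4 * s * j) (T t)) m′) (sym (+-suc j r)) ⟩
          shift (4 * s) (shift (4 * s * j) (T (j + suc r))) m′ ∎) m)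
        (𝒫-shift P₃ N (4 * s) (λ j → shift (4 * s * j) (T (j + suc r))) m)
        where
        open ≡-Reasoning
        exponent : ∀ s j → 4 * s * suc j ≡ 4 * s + 4 * s * j
        exponent = solve-∀

    Y-rec₁ : ∀ s r → Y s r ≈[ N ] Y s (suc r) ⊕ shift (1 + 4 * r) (Y (suc s) r)
    Y-rec₁ s r = ≈-trans N (𝒫-≈ P₃ N N (λ j → shift-≈ (4 * s * j) N (T-rec (j + r))))
      (≐⇒≈ N (λ n → trans (𝒫-cong P₃ N (λ j → shift-⊕ (4 * s * j) (T (suc (j + r))) (shift (1 + 4 * (j + r)) (T (j + r)))) n)
        (trans (𝒫-⊕ P₃ N (λ j → shift (4 * s * j) (T (suc (j + r)))) (λ j → shift (4 * s * j) (shift (1 + 4 * (j + r)) (T (j + r)))) n)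
        (cong₂ _xor_ (𝒫-cong P₃ N (λ j m → cong (λ t → shift (4 * s * j) (T t) m) (sym (+-suc j r))) n)
          (trans (𝒫-cong P₃ N reorder n) (𝒫-shift P₃ N (1 + 4 * r) (λ j → shift (4 * suc s * j) (T (j + r))) n))))))
      where
      reorder : ∀ j → shift (4 * s * j) (shift (1 + 4 * (j + r)) (T (j + r))) ≐ shift (1 + 4 * r) (shift (4 * suc s * j) (T (j + r)))
      reorder j m = begin
        shift (4 * s * j) (shift (1 + 4 * (j + r)) (T (j + r))) m
          ≡⟨ shift-+ (4 * s * j) (1 + 4 * (j + r)) (T (j + r)) m ⟩
        shift (4 * s * j + (1 + 4 * (j + r))) (T (j + r)) m
          ≡⟨ shift-exponent (T (j + r)) (exponent s j r) m ⟩
        shift (1 + 4 * r + 4 * suc s * j) (T (j + r)) m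
          ≡⟨ shift-+ (1 + 4 * r) (4 * suc s * j) (T (j + r)) m ⟨
        shift (1 + 4 * r) (shift (4 * suc s * j) (T (j + r))) m ∎
        where
        open ≡-Reasoning
        exponent : ∀ s j r → 4 * s * j + (1 + 4 * (j + r)) ≡ 1 + 4 * r + 4 * suc s * j
        exponent = solve-∀

    -- products of N + 2 factors: one more than needed below degree N, so that one factor can be peeled off
    len : ℕ
    len = suc (suc N)

    N<len : N < len
    N<len = ≤-trans (n<1+n N) (n≤1+n (suc N))

    ≤len : ∀ {m} → m ≤ N → m ≤ len
    ≤len m≤N = ≤-trans m≤N (<⇒≤ N<len)

    poch-peel : ∀ α α′ g → α + 4 ≡ α′ → poch α 4 len g ≈[ N ] [1+q^ α ]* poch α′ 4 len g
    poch-peel α α′ g α+4≡α′ = [1+q^]-≈ α N (≈-trans N (poch-≈-length (α + 4) 4 g N (s≤s z≤n) (n<1+n N) N<len)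
      (≐⇒≈ N (poch-start 4 len g α+4≡α′)))

    A B : ℕ → Series → Series
    A s = poch (3 + 4 * s) 4 len
    B r = poch (1 + 4 * r) 4 len

    C : ℕ → Series
    C u = poch (4 + 4 * u) 4 len 1ₛ

    W : ℕ → ℕ → Series
    W s r = A s (B r (Y s r))

    +4-step : ∀ c s → (c + 4 * s) + 4 ≡ c + 4 * suc s
    +4-step = solve-∀

    AB-⊕-shift : ∀ s r f c g → A s (B r (f ⊕ shift c g)) ≐ A s (B r f) ⊕ shift c (A s (B r g))
    AB-⊕-shift s r f c g n = trans
      (poch-cong (3 + 4 * s) 4 len (λ m → trans (poch-⊕ (1 + 4 * r) 4 len f (shift c g) m) (cong (B r f m xor_) (poch-shift (1 + 4 * r) 4 len c g m))) n)
      (trans (poch-⊕ (3 + 4 * s) 4 len (B r f) (shift c (B r g)) n) (cong (A s (B r f) n xor_) (poch-shift (3 + 4 * s) 4 len c (B r g) n)))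

    peel-A : ∀ s r f → A s (B r f) ≈[ N ] [1+q^ (3 + 4 * s) ]* A (suc s) (B r f)
    peel-A s r f = poch-peel (3 + 4 * s) (3 + 4 * suc s) (B r f) (+4-step 3 s)

    peel-B : ∀ s r f → A s (B r f) ≈[ N ] [1+q^ (1 + 4 * r) ]* A s (B (suc r) f)
    peel-B s r f = ≈-trans N (poch-≈ (3 + 4 * s) 4 len N (poch-peel (1 + 4 * r) (1 + 4 * suc r) f (+4-step 1 r)))
      (≐⇒≈ N (poch-[1+q^] (3 + 4 * s) 4 len (1 + 4 * r) (B (suc r) f)))

    W-rec₃ : ∀ s r → W s r ≈[ N ] [1+q^ (3 + 4 * s) ]* W (suc s) r ⊕ shift (3 + 4 * s) ([1+q^ (1 + 4 * r) ]* W s (suc r))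
    W-rec₃ s r = ≈-trans N (poch-≈ (3 + 4 * s) 4 len N (poch-≈ (1 + 4 * r) 4 len N (Y-rec₃ s r)))
      (≈-trans N (≐⇒≈ N (AB-⊕-shift s r (Y (suc s) r) (3 + 4 * s) (Y s (suc r))))
      (⊕-≈ N (peel-A s r (Y (suc s) r)) (shift-≈ (3 + 4 * s) N (peel-B s r (Y s (suc r))))))

    W-rec₁ : ∀ s r → W s r ≈[ N ] [1+q^ (1 + 4 * r) ]* W s (suc r) ⊕ shift (1 + 4 * r) ([1+q^ (3 + 4 * s) ]* W (suc s) r)
    W-rec₁ s r = ≈-trans N (poch-≈ (3 + 4 * s) 4 len N (poch-≈ (1 + 4 * r) 4 len N (Y-rec₁ s r)))
      (≈-trans N (≐⇒≈ N (AB-⊕-shift s r (Y s (suc r)) (1 + 4 * r) (Y (suc s) r)))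
      (⊕-≈ N (peel-B s r (Y s (suc r))) (shift-≈ (1 + 4 * r) N (peel-A s r (Y (suc s) r)))))

    -- Comparing the two recursions gives (1 + q^a)(1 + q^b) W (s + 1) r = (1 + q^a)(1 + q^b) W s (r + 1).
    W-suc-comm : ∀ s r → W (suc s) r ≈[ N ] W s (suc r)
    W-suc-comm s r = [1+q^]-cancel b N (s≤s z≤n) ([1+q^]-cancel a N (s≤s z≤n) both)
      where
      a = 3 + 4 * s
      b = 1 + 4 * r
      X = W (suc s) r
      Z = W s (suc r)
      rearrange : ∀ {p q u v} → p xor q ≡ u xor v → p xor v ≡ u xor q
      rearrange {p} {q} {u} {v} e = begin
        p xor v                   ≡⟨ solve 3 (λ p q v → p :+ v := (p :+ q) :+ (q :+ v)) refl p q v ⟩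
        (p xor q) xor (q xor v)   ≡⟨ cong (_xor (q xor v)) e ⟩
        (u xor v) xor (q xor v)   ≡⟨ solve 3 (λ u q v → (u :+ v) :+ (q :+ v) := u :+ q) refl u q v ⟩
        u xor q                   ∎
        where open ≡-Reasoning
      both : [1+q^ a ]* [1+q^ b ]* X ≈[ N ] [1+q^ a ]* [1+q^ b ]* Z
      both n n≤N = trans ([1+q^]-comm a b X n)
        (rearrange {([1+q^ a ]* X) n} {shift a ([1+q^ b ]* Z) n} {([1+q^ b ]* Z) n} {shift b ([1+q^ a ]* X) n}
          (trans (sym (W-rec₃ s r n n≤N)) (W-rec₁ s r n n≤N)))

    W-rec : ∀ s r → W s r ≈[ N ] [1+q^ (4 + 4 * (s + r)) ]* W (suc s) r
    W-rec s r = ≈-trans N (W-rec₃ s r)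
      (≈-trans N (⊕-≈ N (≈-refl {[1+q^ (3 + 4 * s) ]* W (suc s) r} N) (shift-≈ (3 + 4 * s) N ([1+q^]-≈ (1 + 4 * r) N (≈-sym N (W-suc-comm s r)))))
      (≐⇒≈ N (λ n → trans ([1+q^]-⊕-shift (3 + 4 * s) (1 + 4 * r) (W (suc s) r) n) ([1+q^]-exponent (W (suc s) r) (exponent s r) n))))
      where
      exponent : ∀ s r → 3 + 4 * s + (1 + 4 * r) ≡ 4 + 4 * (s + r)
      exponent = solve-∀

    N<c+4s : ∀ c s → N < s → N < c + 4 * s
    N<c+4s c s N<s = <-≤-trans N<s (≤-trans (m≤n*m s 4) (m≤n+m (4 * s) c))

    T-large : ∀ u → N < u → T u ≈[ N ] 1ₛ
    T-large u N<u = ≈-trans N (𝒫-empty-only P₁ N (λ l → q^ (4 * u * l)) N (λ l → shift-beyond (4 * u * suc l) 1ₛ N (N<4us u l N<u)))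
      (≐⇒≈ N (shift-exponent 1ₛ (*-zeroʳ (4 * u))))
      where
      N<4us : ∀ u l → N < u → N < 4 * u * suc l
      N<4us u l N<u = <-≤-trans (N<c+4s 0 u N<u) (m≤m*n (4 * u) (suc l))

    Y-large : ∀ s r → N < s → N < r → Y s r ≈[ N ] 1ₛ
    Y-large s r N<s N<r = ≈-trans N (𝒫-empty-only P₃ N (λ j → shift (4 * s * j) (T (j + r))) N (λ j → shift-beyond (4 * s * suc j) (T (suc j + r)) N
        (<-≤-trans (N<c+4s 0 s N<s) (m≤m*n (4 * s) (suc j)))))
      (≈-trans N (≐⇒≈ N (shift-exponent (T r) (*-zeroʳ (4 * s)))) (T-large r N<r))

    W-large : ∀ s r → N < s → N < r → W s r ≈[ N ] 1ₛ
    W-large s r N<s N<r = ≈-trans N (poch-≈ (3 + 4 * s) 4 len N (poch-≈ (1 + 4 * r) 4 len N (Y-large s r N<s N<r)))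
      (≈-trans N (poch-beyond (3 + 4 * s) 4 len _ N (N<c+4s 3 s N<s)) (poch-beyond (1 + 4 * r) 4 len 1ₛ N (N<c+4s 1 r N<r)))

    C-large : ∀ u → N < u → C u ≈[ N ] 1ₛ
    C-large u N<u = poch-beyond (4 + 4 * u) 4 len 1ₛ N (N<c+4s 4 u N<u)

    C-peel : ∀ u → C u ≈[ N ] [1+q^ (4 + 4 * u) ]* C (suc u)
    C-peel u = poch-peel (4 + 4 * u) (4 + 4 * suc u) 1ₛ (+4-step 4 u)

    W≈C : ∀ s r → W s r ≈[ N ] C (s + r)
    W≈C = downward-induction (suc N) (λ s → ∀ r → W s r ≈[ N ] C (s + r)) large-s (λ s ih r → from-suc s r (ih r))
      where
      from-suc : ∀ s r → W (suc s) r ≈[ N ] C (suc (s + r)) → W s r ≈[ N ] C (s + r)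
      from-suc s r ih = ≈-trans N (W-rec s r) (≈-trans N ([1+q^]-≈ (4 + 4 * (s + r)) N ih) (≈-sym N (C-peel (s + r))))
      large-s : ∀ s → N < s → ∀ r → W s r ≈[ N ] C (s + r)
      large-s s N<s = downward-induction (suc N) (λ r → W s r ≈[ N ] C (s + r))
        (λ r N<r → ≈-trans N (W-large s r N<s N<r) (≈-sym N (C-large (s + r) (≤-trans N<r (m≤n+m r s)))))
        (λ r ih → from-suc s r (≈-trans N (W-suc-comm s r) (≈-trans N ih (≐⇒≈ N (λ n → cong (λ u → C u n) (+-suc s r))))))

    -- (q; q²) Y 0 0 = (q; q⁴)(q³; q⁴) Y 0 0 = W 0 0 = (q⁴; q⁴), and (q; q)(q; q²) ≡ 1
    Y≈ : Y 0 0 ≈[ N ] poch 4 4 len (poch 1 1 len 1ₛ)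
    Y≈ = ≈-trans N (≈-sym N (poch-inverse len (Y 0 0) N N<len))
      (≈-trans N (poch-≈ 1 1 len N odd-parts)
      (≐⇒≈ N (poch-comm 1 1 len 4 4 len 1ₛ)))
      where
      odd-parts : poch 1 2 len (Y 0 0) ≈[ N ] C 0
      odd-parts = ≈-trans N (poch-≈-length 1 2 (Y 0 0) N (s≤s z≤n) N<len (≤-trans N<len (m≤m+n len len)))
        (≈-trans N (≐⇒≈ N (λ n → sym (poch-interleave 1 2 len (Y 0 0) n)))
        (≈-trans N (≐⇒≈ N (poch-comm 1 4 len 3 4 len (Y 0 0))) (W≈C 0 0)))

module CopartitionParity where

  open import Defs
  open XorSums
  open Series
  open PartitionSums
  open PartitionTransform
  open CopartitionSeries
  open Pentagonal using (PentagonalMultiple; module Euler)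
  open import Data.Bool using (Bool; true; false; if_then_else_)
  open import Data.List using (List; []; _∷_; length; replicate; upTo)
  open import Data.Nat using (ℕ; zero; suc; _+_; _*_; _∸_; _≤_; _<_; s≤s; z≤n; _≟_)
  open import Data.Nat.ListAction using (sum)
  open import Data.Nat.Properties
  open import Data.Product using (Σ; _×_; _,_)
  open import Function using (id)
  open import Relation.Binary.PropositionalEquality
  open import Relation.Nullary.Decidable using (⌊_⌋)

  hasSize : ℕ → List ℕ → List ℕ → Bool
  hasSize n γ σ = ⌊ sum γ + sum (replicate (length σ) (4 * length γ)) + sum σ ≟ n ⌋

  odd-cp-as-⨁ : ∀ n → odd (cpℕ 3 1 4 n) ≡
    ⨁[ g ∈ upTo (suc n) ] ⨁[ γ ∈ partitions P₃ g ] ⨁[ s ∈ upTo (suc n) ] ⨁[ σ ∈ partitions P₁ s ] hasSize n γ σ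
  odd-cp-as-⨁ n =
    trans (odd-length-concatMap byγ-size (upTo (suc n))) (⨁∈-cong (upTo (suc n)) λ g →
    trans (odd-length-concatMap byγ (partitions P₃ g)) (⨁∈-cong (partitions P₃ g) λ γ →
    trans (odd-length-concatMap (byσ-size γ) (upTo (suc n))) (⨁∈-cong (upTo (suc n)) λ s →
    trans (odd-length-concatMap (byσ γ) (partitions P₁ s)) (⨁∈-cong (partitions P₁ s) λ σ →
    odd-singleton (hasSize n γ σ)))))
    where
    Copartition = List ℕ × List ℕ × List ℕ
    byσ : List ℕ → List ℕ → List Copartition
    byσ γ σ = if hasSize n γ σ then (γ , replicate (length σ) (4 * length γ) , σ) ∷ [] else []
    byσ-size : List ℕ → ℕ → List Copartition
    byσ-size γ s = Data.List.concatMap (byσ γ) (partitions P₁ s)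
    byγ : List ℕ → List Copartition
    byγ γ = Data.List.concatMap (byσ-size γ) (upTo (suc n))
    byγ-size : ℕ → List Copartition
    byγ-size g = Data.List.concatMap byγ (partitions P₃ g)
    odd-singleton : ∀ b {x : Copartition} → odd (length (if b then x ∷ [] else [])) ≡ b
    odd-singleton true  = refl
    odd-singleton false = refl

  sizeIs : ℕ → ℕ → ℕ → ℕ → ℕ → Bool
  sizeIs n g j s l = ⌊ g + sum (replicate l (4 * j)) + s ≟ n ⌋

  q^-as-≟ : ∀ e x → (q^ e) x ≡ ⌊ e ≟ x ⌋
  q^-as-≟ zero    zero    = refl
  q^-as-≟ zero    (suc x) = refl
  q^-as-≟ (suc e) zero    = refl
  q^-as-≟ (suc e) (suc x) = trans (q^-as-≟ e x) (isYes-⇔ (e ≟ x) (suc e ≟ suc x) (cong suc) suc-injective)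

  sizeIs-monomial : ∀ n g j s l → g ≤ n → s ≤ n ∸ g → sizeIs n g j s l ≡ (q^ (4 * j * l)) (n ∸ g ∸ s)
  sizeIs-monomial n g j s l g≤n s≤n∸g =
    trans (isYes-⇔ (g + ρ + s ≟ n) (4 * j * l ≟ n ∸ g ∸ s) to from) (sym (q^-as-≟ (4 * j * l) (n ∸ g ∸ s)))
    where
    ρ = sum (replicate l (4 * j))
    ρ≡ : ρ ≡ 4 * j * l
    ρ≡ = trans (sum-replicate l (4 * j)) (*-comm l (4 * j))
    to : g + ρ + s ≡ n → 4 * j * l ≡ n ∸ g ∸ s
    to size≡n = begin
      4 * j * l              ≡⟨ ρ≡ ⟨
      ρ                      ≡⟨ m+n∸n≡m ρ s ⟨
      ρ + s ∸ s              ≡⟨ cong (_∸ s) (m+n∸m≡n g (ρ + s)) ⟨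
      g + (ρ + s) ∸ g ∸ s    ≡⟨ cong (λ m → m ∸ g ∸ s) (trans (sym (+-assoc g ρ s)) size≡n) ⟩
      n ∸ g ∸ s              ∎
      where open ≡-Reasoning
    from : 4 * j * l ≡ n ∸ g ∸ s → g + ρ + s ≡ n
    from ρ≡n∸g∸s = begin
      g + ρ + s              ≡⟨ +-assoc g ρ s ⟩
      g + (ρ + s)            ≡⟨ cong (λ r → g + (r + s)) (trans ρ≡ ρ≡n∸g∸s) ⟩
      g + (n ∸ g ∸ s + s)    ≡⟨ cong (g +_) (m∸n+n≡m s≤n∸g) ⟩
      g + (n ∸ g)            ≡⟨ m+[n∸m]≡n g≤n ⟩
      n                      ∎
      where open ≡-Reasoning

  sizeIs-large : ∀ n g j s l → n ∸ g < s → sizeIs n g j s l ≡ false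
  sizeIs-large n g j s l n∸g<s = isYes-false (g + ρ + s ≟ n) λ size≡n → <⇒≱ n∸g<s (subst (s ≤_) (n∸g≡ size≡n) (m≤n+m s ρ))
    where
    ρ = sum (replicate l (4 * j))
    n∸g≡ : g + ρ + s ≡ n → ρ + s ≡ n ∸ g
    n∸g≡ size≡n = trans (sym (m+n∸m≡n g (ρ + s))) (cong (_∸ g) (trans (sym (+-assoc g ρ s)) size≡n))

  odd-cp : ∀ n → odd (cpℕ 3 1 4 n) ≡ Truncated.Y n 0 0 n
  odd-cp n = begin
    odd (cpℕ 3 1 4 n)                ≡⟨ odd-cp-as-⨁ n ⟩
    ⨁[ g ∈ upTo (suc n) ] of-size g  ≡⟨ ⨁∈-applyUpTo id (suc n) of-size ⟩
    ⨁[ g < suc n ] of-size g         ≡⟨ ⨁<-cong (suc n) (λ g g<1+n → by-γ g (≤-pred g<1+n)) ⟩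
    Y 0 0 n                          ∎
    where
    open Truncated n
    open ≡-Reasoning
    of-size : ℕ → Bool
    of-size g = ⨁[ γ ∈ partitions P₃ g ] ⨁[ s ∈ upTo (suc n) ] ⨁[ σ ∈ partitions P₁ s ] hasSize n γ σ
    by-σ : ∀ g j → g ≤ n → ⨁[ s ∈ upTo (suc n) ] ⨁[ σ ∈ partitions P₁ s ] sizeIs n g j (sum σ) (length σ) ≡ T j (n ∸ g)
    by-σ g j g≤n = begin
      ⨁[ s ∈ upTo (suc n) ] ⨁parts P₁ s s (λ σ → sizeIs n g j (sum σ) (length σ))
        ≡⟨ ⨁∈-applyUpTo id (suc n) (λ s → ⨁parts P₁ s s (λ σ → sizeIs n g j (sum σ) (length σ))) ⟩
      ⨁[ s < suc n ] ⨁parts P₁ s s (λ σ → sizeIs n g j (sum σ) (length σ))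
        ≡⟨ ⨁<-cong (suc n) (λ s _ → ⨁parts-sum P₁ s s (λ s σ → sizeIs n g j s (length σ))) ⟩
      ⨁[ s < suc n ] ⨁parts P₁ s s (λ σ → sizeIs n g j s (length σ))
        ≡⟨ ⨁<-vanishing-tail (suc (n ∸ g)) (suc n) _ (s≤s (m∸n≤m n g))
             (λ s n∸g<s _ → ⨁parts-false P₁ s s (λ σ → sizeIs-large n g j s (length σ) n∸g<s)) ⟩
      ⨁[ s < suc (n ∸ g) ] ⨁parts P₁ s s (λ σ → sizeIs n g j s (length σ))
        ≡⟨ ⨁<-cong (suc (n ∸ g)) (λ s s<1+n∸g → trans
             (⨁parts-cong P₁ s s (λ σ → sizeIs-monomial n g j s (length σ) g≤n (≤-pred s<1+n∸g)))
             (sym (⨁parts-bound P₁ s n _ (≤-trans (≤-pred s<1+n∸g) (m∸n≤m n g))))) ⟩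
      T j (n ∸ g) ∎
      where open ≡-Reasoning
    by-γ : ∀ g → g ≤ n → ⨁[ γ ∈ partitions P₃ g ] ⨁[ s ∈ upTo (suc n) ] ⨁[ σ ∈ partitions P₁ s ] hasSize n γ σ ≡
      ⨁parts P₃ g n (λ γ → shift (4 * 0 * length γ) (T (length γ + 0)) (n ∸ g))
    by-γ g g≤n = begin
      ⨁parts P₃ g g (λ γ → ⨁[ s ∈ upTo (suc n) ] ⨁[ σ ∈ partitions P₁ s ] sizeIs n (sum γ) (length γ) (sum σ) (length σ))
        ≡⟨ ⨁parts-sum P₃ g g (λ g′ γ → ⨁[ s ∈ upTo (suc n) ] ⨁[ σ ∈ partitions P₁ s ] sizeIs n g′ (length γ) (sum σ) (length σ)) ⟩
      ⨁parts P₃ g g (λ γ → ⨁[ s ∈ upTo (suc n) ] ⨁[ σ ∈ partitions P₁ s ] sizeIs n g (length γ) (sum σ) (length σ))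
        ≡⟨ ⨁parts-cong P₃ g g (λ γ → trans (by-σ g (length γ) g≤n) (cong (λ j → T j (n ∸ g)) (sym (+-identityʳ (length γ))))) ⟩
      ⨁parts P₃ g g (λ γ → T (length γ + 0) (n ∸ g))
        ≡⟨ ⨁parts-bound P₃ g n _ g≤n ⟨
      ⨁parts P₃ g n (λ γ → T (length γ + 0) (n ∸ g)) ∎
      where open ≡-Reasoning

  odd-cp⇒pentagonal : ∀ n → odd (cpℕ 3 1 4 n) ≡ true →
    Σ ℕ λ i → i ≤ n × PentagonalMultiple 4 i × PentagonalMultiple 1 (n ∸ i)
  odd-cp⇒pentagonal n odd-cp≡true with ⨁<-true (suc n) _ (begin
      (poch 4 4 len 1ₛ ∗ poch 1 1 len 1ₛ) n  ≡⟨ poch-as-∗ 4 4 len (poch 1 1 len 1ₛ) n ⟨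
      poch 4 4 len (poch 1 1 len 1ₛ) n       ≡⟨ Y≈ n ≤-refl ⟨
      Y 0 0 n                               ≡⟨ odd-cp n ⟨
      odd (cpℕ 3 1 4 n)                     ≡⟨ odd-cp≡true ⟩
      true                                  ∎)
    where
    open Truncated n
    open ≡-Reasoning
  ... | i , i<1+n , term≡true with ∧≡true term≡true
  ...   | e₄ , e₁ = i , ≤-pred i<1+n , Euler.poch-support 4 (s≤s z≤n) len i (≤len (≤-pred i<1+n)) e₄ ,
                    Euler.poch-support 1 ≤-refl len (n ∸ i) (≤len (m∸n≤m n i)) e₁
    where open Truncated n

module SumsOfSquares where

  open Pentagonal using (triangular; Pentagonal; plus; minus; PentagonalMultiple)
  open import Data.Empty using (⊥; ⊥-elim)
  open import Data.Nat using (ℕ; zero; suc; _+_; _*_; _∸_; _^_; _≤_; _<_; z≤n; s≤s; _%_; _/_; >-nonZero)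
  open import Data.Nat.Combinatorics using (_C_; nCk+nC[k+1]≡[n+1]C[k+1]; nCn≡1; nC1≡n; k>n⇒nCk≡0)
  open import Data.Nat.Divisibility
  open import Data.Nat.DivMod using (m≡m%n+[m/n]*n)
  open import Data.Nat.Primality using (Prime; euclidsLemma; prime⇒nonZero)
  open import Data.Nat.Properties
  open import Data.Nat.Tactic.RingSolver using (solve-∀)
  open import Data.Product using (Σ; _×_; _,_)
  open import Data.Sum using (inj₁; inj₂)
  open import Function using (_∘_)
  open import Relation.Binary.PropositionalEquality
  open import Relation.Nullary using (¬_; yes; no)

  triangular-double : ∀ m → 2 * triangular m ≡ m * suc m
  triangular-double zero    = refl
  triangular-double (suc m) = trans (*-distribˡ-+ 2 (suc m) (triangular m))
    (trans (cong (2 * suc m +_) (triangular-double m)) (identity m))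
    where
    identity : ∀ m → 2 * suc m + m * suc m ≡ suc m * suc (suc m)
    identity = solve-∀

  pentagonal-square : ∀ {y} → Pentagonal y → Σ ℕ λ w → 24 * y + 1 ≡ w * w
  pentagonal-square (plus k)  = 6 * k + 1 , square k (triangular k) (triangular-double k)
    where
    square : ∀ k t → 2 * t ≡ k * suc k → 24 * (k * k + t) + 1 ≡ (6 * k + 1) * (6 * k + 1)
    square k t 2t≡ = trans (expand k t) (trans (cong (λ s → 24 * (k * k) + 12 * s + 1) 2t≡) (collect k))
      where
      expand : ∀ k t → 24 * (k * k + t) + 1 ≡ 24 * (k * k) + 12 * (2 * t) + 1
      expand = solve-∀
      collect : ∀ k → 24 * (k * k) + 12 * (k * suc k) + 1 ≡ (6 * k + 1) * (6 * k + 1)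
      collect = solve-∀
  pentagonal-square (minus k) = 6 * k + 5 , square k (triangular k) (triangular-double k)
    where
    square : ∀ k t → 2 * t ≡ k * suc k → 24 * (suc k * suc k + t) + 1 ≡ (6 * k + 5) * (6 * k + 5)
    square k t 2t≡ = trans (expand k t) (trans (cong (λ s → 24 * (suc k * suc k) + 12 * s + 1) 2t≡) (collect k))
      where
      expand : ∀ k t → 24 * (suc k * suc k + t) + 1 ≡ 24 * (suc k * suc k) + 12 * (2 * t) + 1
      expand = solve-∀
      collect : ∀ k → 24 * (suc k * suc k) + 12 * (k * suc k) + 1 ≡ (6 * k + 5) * (6 * k + 5)
      collect = solve-∀

  -- 24 n + 5 = (24 y + 1) + 4 (24 y′ + 1) for n = y + 4 y′
  sum-of-squares : ∀ n i → i ≤ n → PentagonalMultiple 4 i → PentagonalMultiple 1 (n ∸ i) →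
    Σ ℕ λ v → Σ ℕ λ w → 24 * n + 5 ≡ v * v + 4 * (w * w)
  sum-of-squares n i i≤n (y₄ , i≡4y₄ , pent₄) (y₁ , n∸i≡y₁ , pent₁) with pentagonal-square pent₄ | pentagonal-square pent₁
  ... | w , 24y₄+1≡w² | v , 24y₁+1≡v² = v , w , (begin
    24 * n + 5                              ≡⟨ cong (λ m → 24 * m + 5) (trans (sym (m∸n+n≡m i≤n)) (cong₂ _+_ n∸i≡y₁ i≡4y₄)) ⟩
    24 * (1 * y₁ + 4 * y₄) + 5              ≡⟨ split y₁ y₄ ⟩
    (24 * y₁ + 1) + 4 * (24 * y₄ + 1)       ≡⟨ cong₂ (λ a b → a + 4 * b) 24y₁+1≡v² 24y₄+1≡w² ⟩
    v * v + 4 * (w * w)                     ∎)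
    where
    open ≡-Reasoning
    split : ∀ y₁ y₄ → 24 * (1 * y₁ + 4 * y₄) + 5 ≡ (24 * y₁ + 1) + 4 * (24 * y₄ + 1)
    split = solve-∀

  ∑< : ℕ → (ℕ → ℕ) → ℕ
  ∑< zero    f = 0
  ∑< (suc c) f = f 0 + ∑< c (f ∘ suc)

  syntax ∑< c (λ k → e) = ∑[ k < c ] e

  ∑<-last : ∀ c f → ∑< (suc c) f ≡ ∑< c f + f c
  ∑<-last zero    f = +-identityʳ (f 0)
  ∑<-last (suc c) f = trans (cong (f 0 +_) (∑<-last c (f ∘ suc))) (sym (+-assoc (f 0) _ _))

  ∑<-cong : ∀ c {f g} → (∀ k → f k ≡ g k) → ∑< c f ≡ ∑< c g
  ∑<-cong zero    f≡g = refl
  ∑<-cong (suc c) f≡g = cong₂ _+_ (f≡g 0) (∑<-cong c (f≡g ∘ suc))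

  ∑<-+ : ∀ c f g → ∑[ k < c ] (f k + g k) ≡ ∑< c f + ∑< c g
  ∑<-+ zero    f g = refl
  ∑<-+ (suc c) f g = trans (cong (f 0 + g 0 +_) (∑<-+ c (f ∘ suc) (g ∘ suc))) (+-assoc-swap (f 0) (g 0) _ _)
    where
    +-assoc-swap : ∀ a b c d → a + b + (c + d) ≡ a + c + (b + d)
    +-assoc-swap = solve-∀

  ∑<-* : ∀ c x f → ∑[ k < c ] (x * f k) ≡ x * ∑< c f
  ∑<-* zero    x f = sym (*-zeroʳ x)
  ∑<-* (suc c) x f = trans (cong (x * f 0 +_) (∑<-* c x (f ∘ suc))) (sym (*-distribˡ-+ x (f 0) _))

  ∑<-∣ : ∀ d c f → (∀ k → k < c → d ∣ f k) → d ∣ ∑< c f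
  ∑<-∣ d zero    f d∣f = d ∣0
  ∑<-∣ d (suc c) f d∣f = ∣m∣n⇒∣m+n (d∣f 0 (s≤s z≤n)) (∑<-∣ d c (f ∘ suc) (λ k k<c → d∣f (suc k) (s≤s k<c)))

  pascal : ∀ n k → suc n C suc k ≡ n C k + n C suc k
  pascal n k = sym (nCk+nC[k+1]≡[n+1]C[k+1] n k)

  C-absorption : ∀ n k → suc k * (suc n C suc k) ≡ suc n * (n C k)
  C-absorption zero    zero    = refl
  C-absorption zero    (suc k) rewrite k>n⇒nCk≡0 {1} {suc (suc k)} (s≤s (s≤s z≤n)) | k>n⇒nCk≡0 {0} {suc k} (s≤s z≤n)
    = *-zeroʳ (suc (suc k))
  C-absorption (suc n) zero    = trans (*-identityˡ _) (trans (nC1≡n (suc (suc n))) (sym (*-identityʳ _)))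
  C-absorption (suc n) (suc k) = begin
    suc (suc k) * (suc (suc n) C suc (suc k))
      ≡⟨ cong (suc (suc k) *_) (pascal (suc n) (suc k)) ⟩
    suc (suc k) * (suc n C suc k + suc n C suc (suc k))
      ≡⟨ cong (λ c → suc (suc k) * (c + suc n C suc (suc k))) (pascal n k) ⟩
    suc (suc k) * ((a + b) + y)
      ≡⟨ expand k a b y ⟩
    (a + b) + suc k * (a + b) + suc (suc k) * y
      ≡⟨ cong₂ (λ u v → (a + b) + u + v) (trans (cong (suc k *_) (sym (pascal n k))) (C-absorption n k)) (C-absorption n (suc k)) ⟩
    (a + b) + suc n * a + suc n * b
      ≡⟨ collect n a b ⟩
    suc (suc n) * (a + b)
      ≡⟨ cong (suc (suc n) *_) (pascal n k) ⟨
    suc (suc n) * (suc n C suc k) ∎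
    where
    open ≡-Reasoning
    a = n C k
    b = n C suc k
    y = suc n C suc (suc k)
    expand : ∀ k a b y → suc (suc k) * ((a + b) + y) ≡ (a + b) + suc k * (a + b) + suc (suc k) * y
    expand = solve-∀
    collect : ∀ n a b → (a + b) + suc n * a + suc n * b ≡ suc (suc n) * (a + b)
    collect = solve-∀

  binomial : ∀ x n → (x + 1) ^ n ≡ ∑[ k < suc n ] ((n C k) * x ^ k)
  binomial x zero    = refl
  binomial x (suc n) = trans (cong ((x + 1) *_) (binomial x n)) (sym (begin
    ∑[ k < suc (suc n) ] ((suc n C k) * x ^ k)
      ≡⟨ cong (1 +_) (∑<-cong (suc n) (λ k → trans (cong (_* x ^ suc k) (pascal n k)) (distribute (n C k) (n C suc k) x (x ^ k)))) ⟩
    1 + ∑[ k < suc n ] (x * ((n C k) * x ^ k) + (n C suc k) * x ^ suc k)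
      ≡⟨ cong (1 +_) (trans (∑<-+ (suc n) (λ k → x * ((n C k) * x ^ k)) (λ k → (n C suc k) * x ^ suc k)) (cong (_+ S₊) (∑<-* (suc n) x g))) ⟩
    1 + (x * S + S₊)
      ≡⟨ reassoc (x * S) S₊ ⟩
    x * S + (1 + S₊)
      ≡⟨ cong (x * S +_) 1+S₊≡S ⟩
    x * S + S
      ≡⟨ factor x S ⟩
    (x + 1) * S ∎))
    where
    open ≡-Reasoning
    g : ℕ → ℕ
    g k = (n C k) * x ^ k
    S = ∑< (suc n) g
    S₊ = ∑[ k < suc n ] ((n C suc k) * x ^ suc k)
    1+S₊≡S : 1 + S₊ ≡ S
    1+S₊≡S = trans (∑<-last (suc n) g) (trans (cong (λ c → S + c * x ^ suc n) (k>n⇒nCk≡0 {n} {suc n} ≤-refl)) (+-identityʳ S))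
    distribute : ∀ a b x y → (a + b) * (x * y) ≡ x * (a * y) + b * (x * y)
    distribute = solve-∀
    reassoc : ∀ a b → 1 + (a + b) ≡ a + (1 + b)
    reassoc = solve-∀
    factor : ∀ x s → x * s + s ≡ (x + 1) * s
    factor = solve-∀

  m≤m^[1+n] : ∀ m n → m ≤ m ^ suc n
  m≤m^[1+n] zero    n = z≤n
  m≤m^[1+n] (suc m) n = m≤m*n (suc m) (suc m ^ n) {{m^n≢0 (suc m) n}}

  module Fermat {q} (p-prime : Prime (suc q)) where

    p∣pC : ∀ k → k < q → suc q ∣ suc q C suc k
    p∣pC k k<q with euclidsLemma (suc k) (suc q C suc k) p-prime (divides (q C k) (trans (C-absorption q k) (*-comm (suc q) (q C k))))
    ... | inj₁ p∣1+k = ⊥-elim (<⇒≱ (s≤s k<q) (∣⇒≤ p∣1+k))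
    ... | inj₂ p∣C   = p∣C

    fermat : ∀ a → suc q ∣ a ^ suc q ∸ a
    fermat zero    = divides 0 refl
    fermat (suc a) = subst (suc q ∣_) (sym shape)
      (∣m∣n⇒∣m+n (∑<-∣ (suc q) q middle (λ k k<q → ∣m⇒∣m*n (a ^ suc k) (p∣pC k k<q))) (fermat a))
      where
      middle : ℕ → ℕ
      middle k = (suc q C suc k) * a ^ suc k
      expansion : suc a ^ suc q ≡ 1 + (∑< q middle + a ^ suc q)
      expansion = trans (cong (_^ suc q) (+-comm 1 a)) (trans (binomial a (suc q)) (cong (1 +_) (trans (∑<-last q middle)
        (cong (∑< q middle +_) (trans (cong (_* a ^ suc q) (nCn≡1 (suc q))) (*-identityˡ (a ^ suc q)))))))
      shape : suc a ^ suc q ∸ suc a ≡ ∑< q middle + (a ^ suc q ∸ a)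
      shape = trans (cong (_∸ suc a) expansion) (+-∸-assoc (∑< q middle) (m≤m^[1+n] a q))

    fermat-unit : ∀ a → ¬ suc q ∣ a → suc q ∣ a ^ q ∸ 1
    fermat-unit a p∤a with euclidsLemma a (a ^ q ∸ 1) p-prime (subst (suc q ∣_) factor (fermat a))
      where
      factor : a ^ suc q ∸ a ≡ a * (a ^ q ∸ 1)
      factor = trans (cong (a * a ^ q ∸_) (sym (*-identityʳ a))) (sym (*-distribˡ-∸ a (a ^ q) 1))
    ... | inj₁ p∣a = ⊥-elim (p∤a p∣a)
    ... | inj₂ p∣  = p∣

  odd-power-sum : ∀ {d} A B → d ∣ A + B → ∀ e → d ∣ A ^ suc (2 * e) + B ^ suc (2 * e)
  odd-power-sum {d} A B d∣A+B zero    = subst (d ∣_) (cong₂ _+_ (sym (*-identityʳ A)) (sym (*-identityʳ B))) d∣A+B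
  odd-power-sum {d} A B d∣A+B (suc e) = subst (λ m → d ∣ A ^ suc m + B ^ suc m) (sym (*-suc 2 e))
    (∣m+n∣m⇒∣n (subst (d ∣_) (identity A B (A ^ m) (B ^ m)) (∣m⇒∣m*n (A * A ^ m + B * B ^ m) d∣A+B))
               (∣n⇒∣m*n (A * B) (odd-power-sum A B d∣A+B e)))
    where
    m = suc (2 * e)
    identity : ∀ A B a b → (A + B) * (A * a + B * b) ≡ A * B * (a + b) + (A * (A * a) + B * (B * b))
    identity = solve-∀

  ∣-square⇒∣ : ∀ {p} → Prime p → ∀ v → p ∣ v * v → p ∣ v
  ∣-square⇒∣ p-prime v p∣v² with euclidsLemma v v p-prime p∣v²
  ... | inj₁ p∣v = p∣v
  ... | inj₂ p∣v = p∣v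

  module ThreeModFour {q e} (p-prime : Prime (suc q)) (q≡ : q ≡ 2 * suc (2 * e)) where

    open Fermat p-prime

    3≤p : 3 ≤ suc q
    3≤p = s≤s (subst (2 ≤_) (sym q≡) (*-monoʳ-≤ 2 (s≤s z≤n)))

    p∤2 : ¬ suc q ∣ 2
    p∤2 p∣2 = <⇒≱ (s≤s (s≤s (s≤s z≤n))) (≤-trans 3≤p (∣⇒≤ p∣2))

    -- −1 is not a square: v² ≡ −u² would give 1 ≡ v^(p−1) = (v²)^(2e+1) ≡ −(u²)^(2e+1) = −u^(p−1) ≡ −1.
    ¬∣-sum-of-squares : ∀ v u → ¬ suc q ∣ v → ¬ suc q ∣ u → ¬ suc q ∣ v * v + u * u
    ¬∣-sum-of-squares v u p∤v p∤u p∣v²+u² =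
      p∤2 (∣m+n∣m⇒∣n (subst (suc q ∣_) (sym decompose) p∣vᵠ+uᵠ) (∣m∣n⇒∣m+n (fermat-unit v p∤v) (fermat-unit u p∤u)))
      where
      square-power : ∀ v → (v * v) ^ suc (2 * e) ≡ v ^ q
      square-power v = trans (cong (λ w → (v * w) ^ suc (2 * e)) (sym (*-identityʳ v)))
        (trans (^-*-assoc v 2 (suc (2 * e))) (cong (v ^_) (sym q≡)))
      p∣vᵠ+uᵠ : suc q ∣ v ^ q + u ^ q
      p∣vᵠ+uᵠ = subst (suc q ∣_) (cong₂ _+_ (square-power v) (square-power u)) (odd-power-sum (v * v) (u * u) p∣v²+u² e)
      positive : ∀ v → ¬ suc q ∣ v → 1 ≤ v ^ q
      positive zero    p∤0 = ⊥-elim (p∤0 (suc q ∣0))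
      positive (suc v) _   = m^n>0 (suc v) q
      decompose : (v ^ q ∸ 1 + (u ^ q ∸ 1)) + 2 ≡ v ^ q + u ^ q
      decompose = trans (regroup (v ^ q ∸ 1) (u ^ q ∸ 1)) (cong₂ _+_ (m∸n+n≡m (positive v p∤v)) (m∸n+n≡m (positive u p∤u)))
        where
        regroup : ∀ x y → (x + y) + 2 ≡ (x + 1) + (y + 1)
        regroup = solve-∀

    ∣-sum-of-squares : ∀ v u → suc q ∣ v * v + u * u → suc q ∣ v
    ∣-sum-of-squares v u p∣v²+u² with suc q ∣? v | suc q ∣? u
    ... | yes p∣v | _       = p∣v
    ... | no  _   | yes p∣u = ∣-square⇒∣ p-prime v (∣m+n∣m⇒∣n (subst (suc q ∣_) (+-comm (v * v) (u * u)) p∣v²+u²) (∣m⇒∣m*n u p∣u))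
    ... | no  p∤v | no  p∤u = ⊥-elim (¬∣-sum-of-squares v u p∤v p∤u p∣v²+u²)

  3-mod-4 : ∀ p → p % 4 ≡ 3 → Σ ℕ λ e → p ≡ suc (2 * suc (2 * e))
  3-mod-4 p p%4≡3 = p / 4 , trans (m≡m%n+[m/n]*n p 4) (trans (cong (_+ p / 4 * 4) p%4≡3) (shape (p / 4)))
    where
    shape : ∀ e → 3 + e * 4 ≡ suc (2 * suc (2 * e))
    shape = solve-∀

  ∣-v²+4w² : ∀ {p} → Prime p → p % 4 ≡ 3 → ∀ v w → p ∣ v * v + 4 * (w * w) → p ∣ v × p ∣ w
  ∣-v²+4w² {p} p-prime p%4≡3 v w p∣v²+4w² with 3-mod-4 p p%4≡3
  ... | e , refl = ∣-sum-of-squares v (2 * w) p∣v²+u² , p∣w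
    where
    open ThreeModFour {e = e} p-prime refl
    p∣v²+u² : p ∣ v * v + 2 * w * (2 * w)
    p∣v²+u² = subst (λ x → p ∣ v * v + x) (sym (double-square w)) p∣v²+4w²
      where
      double-square : ∀ w → 2 * w * (2 * w) ≡ 4 * (w * w)
      double-square = solve-∀
    p∣w : p ∣ w
    p∣w with euclidsLemma 2 w p-prime (∣-sum-of-squares (2 * w) v (subst (p ∣_) (+-comm (v * v) _) p∣v²+u²))
    ... | inj₁ p∣2 = ⊥-elim (p∤2 p∣2)
    ... | inj₂ p∣w = p∣w

  -- p | v and p | w give p² | 24 n + 5, hence p | 24 t: impossible for a prime p > 3 and 0 < t < p.
  no-representation : ∀ {p t n} → Prime p → 3 < p → p % 4 ≡ 3 → 1 ≤ t → t < p →
    p ∣ 24 * n + 5 → (p * p ∣ 24 * n + 5 → p * p ∣ 24 * p * t) → ∀ v w → 24 * n + 5 ≢ v * v + 4 * (w * w)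
  no-representation {p} {t} {n} p-prime 3<p p%4≡3 1≤t t<p p∣ p²∣⇒ v w 24n+5≡ =
    p∤24t (*-cancelˡ-∣ p (subst (p * p ∣_) (regroup p t) (p²∣⇒ p²∣)))
    where
    instance
      _ = prime⇒nonZero p-prime
    p∣v×p∣w = ∣-v²+4w² p-prime p%4≡3 v w (subst (p ∣_) 24n+5≡ p∣)
    p²∣ : p * p ∣ 24 * n + 5
    p²∣ with p∣v×p∣w
    ... | p∣v , p∣w = subst (p * p ∣_) (sym 24n+5≡) (∣m∣n⇒∣m+n (*-pres-∣ p∣v p∣v) (∣n⇒∣m*n 4 (*-pres-∣ p∣w p∣w)))
    regroup : ∀ p t → 24 * p * t ≡ p * (24 * t)
    regroup = solve-∀
    small : ∀ {m} → p ∣ suc m → suc m ≤ 3 → ⊥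
    small p∣ m≤3 = <⇒≱ 3<p (≤-trans (∣⇒≤ p∣) m≤3)
    p∤24t : ¬ p ∣ 24 * t
    p∤24t p∣24t with euclidsLemma 24 t p-prime p∣24t
    ... | inj₂ p∣t = <⇒≱ t<p (∣⇒≤ {{>-nonZero 1≤t}} p∣t)
    ... | inj₁ p∣24 with euclidsLemma 2 12 p-prime p∣24
    ...   | inj₁ p∣2 = small p∣2 (s≤s (s≤s z≤n))
    ...   | inj₂ p∣12 with euclidsLemma 2 6 p-prime p∣12
    ...     | inj₁ p∣2 = small p∣2 (s≤s (s≤s z≤n))
    ...     | inj₂ p∣6 with euclidsLemma 2 3 p-prime p∣6
    ...       | inj₁ p∣2 = small p∣2 (s≤s (s≤s z≤n))
    ...       | inj₂ p∣3 = small p∣3 ≤-refl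

open import Defs
open import Data.Nat using (ℕ; _<_; _≤_; _%_)
open import Data.Nat.Divisibility using (_∣_)
open import Data.Nat.Primality using (Prime)
open import Data.Integer using (ℤ; +_; _+_; _-_; _*_)
open import Relation.Binary.PropositionalEquality using (_≡_)
import Data.Integer.Divisibility as ℤD

import Data.Nat as ℕ
import Data.Nat.Divisibility as ℕD
import Data.Integer as ℤ
import Data.Integer.Properties as ℤP
import Data.Integer.Divisibility.Signed as ℤS
open import Data.Integer.Tactic.RingSolver using (solve-∀)
open import Data.Bool.Properties using (¬-not)
open import Data.Product using (_,_)
open import Relation.Binary.PropositionalEquality using (refl; sym; trans; cong; cong₂; subst)
open XorSums using (odd≡false⇒2∣)
open CopartitionParity using (odd-cp⇒pentagonal)
open SumsOfSquares using (sum-of-squares; no-representation)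

∣m-n⇒∣n⇒∣m : ∀ {d m n} → (+ d) ℤS.∣ (+ m - + n) → d ∣ n → d ∣ m
∣m-n⇒∣n⇒∣m {d} {m} {n} d∣m-n d∣n =
  ℤS.∣⇒∣ᵤ (subst ((+ d) ℤS.∣_) ([m-n]+n≡m (+ m) (+ n)) (ℤS.∣m∣n⇒∣m+n d∣m-n (ℤS.∣ᵤ⇒∣ d∣n)))
  where
  [m-n]+n≡m : ∀ m n → (m - n) + n ≡ m
  [m-n]+n≡m = solve-∀

∣m-n⇒∣m⇒∣n : ∀ {d m n} → (+ d) ℤS.∣ (+ m - + n) → d ∣ m → d ∣ n
∣m-n⇒∣m⇒∣n {d} {m} {n} d∣m-n d∣m =
  ℤS.∣⇒∣ᵤ (subst ((+ d) ℤS.∣_) (m-[m-n]≡n (+ m) (+ n)) (ℤS.∣m∣n⇒∣m-n (ℤS.∣ᵤ⇒∣ {+ d} {+ m} d∣m) d∣m-n))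
  where
  m-[m-n]≡n : ∀ m n → m - (m - n) ≡ n
  m-[m-n]≡n = solve-∀

p²∣24s+5-24pt : ∀ p t k δ s → (+ (p ℕ.* p)) ℤD.∣ (+ 24 * δ - + 1) → + (p ℕ.* p) * + k + + p * + t - + 5 * δ ≡ + s →
  (+ (p ℕ.* p)) ℤS.∣ (+ (24 ℕ.* s ℕ.+ 5) - + (24 ℕ.* p ℕ.* t))
p²∣24s+5-24pt p t k δ s p²∣24δ-1 s≡ = subst ((+ (p ℕ.* p)) ℤS.∣_) (sym difference)
  (ℤS.∣m∣n⇒∣m-n (ℤS.∣m⇒∣m*n (+ 24 * + k) ℤS.∣-refl) (ℤS.∣n⇒∣m*n (+ 5) (ℤS.∣ᵤ⇒∣ p²∣24δ-1)))
  where
  expand : ∀ P² P K T D → + 24 * (P² * K + P * T - + 5 * D) + + 5 - + 24 * P * T ≡ P² * (+ 24 * K) - + 5 * (+ 24 * D - + 1)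
  expand = solve-∀
  difference : + (24 ℕ.* s ℕ.+ 5) - + (24 ℕ.* p ℕ.* t) ≡ + (p ℕ.* p) * (+ 24 * + k) - + 5 * (+ 24 * δ - + 1)
  difference = trans (cong₂ _-_ (trans (ℤP.pos-+ (24 ℕ.* s) 5) (cong (_+ + 5) (trans (ℤP.pos-* 24 s) (cong (+ 24 *_) (sym s≡)))))
                                (trans (ℤP.pos-* (24 ℕ.* p) t) (cong (_* + t) (ℤP.pos-* 24 p))))
                     (expand (+ (p ℕ.* p)) (+ p) (+ k) (+ t) δ)

corollary4p7 : (p : ℕ) → Prime p → 3 < p → p % 4 ≡ 3 →
    (δ : ℤ) → (+ (p Data.Nat.* p)) ℤD.∣ (+ 24 * δ - + 1) →
    (t : ℕ) → 1 ≤ t → t < p → (k : ℕ) →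
    2 ∣ cp 3 1 4 (+ (p Data.Nat.* p) * + k + + p * + t - + 5 * δ)
corollary4p7 p p-prime 3<p p%4≡3 δ p²∣24δ-1 t 1≤t t<p k with + (p ℕ.* p) * + k + + p * + t - + 5 * δ in s≡
... | ℤ.-[1+ _ ] = ℕD.divides 0 refl
... | + s = odd≡false⇒2∣ (cpℕ 3 1 4 s) (¬-not λ odd-cp →
    let (i , i≤s , pent₄ , pent₁) = odd-cp⇒pentagonal s odd-cp
        (v , w , 24s+5≡v²+4w²)    = sum-of-squares s i i≤s pent₄ pent₁
    in no-representation {n = s} p-prime 3<p p%4≡3 1≤t t<p p∣24s+5 (∣m-n⇒∣m⇒∣n p²∣) v w 24s+5≡v²+4w²)
  where
  p²∣ : (+ (p ℕ.* p)) ℤS.∣ (+ (24 ℕ.* s ℕ.+ 5) - + (24 ℕ.* p ℕ.* t))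
  p²∣ = p²∣24s+5-24pt p t k δ s p²∣24δ-1 s≡
  p∣24s+5 : p ∣ 24 ℕ.* s ℕ.+ 5
  p∣24s+5 = ∣m-n⇒∣n⇒∣m (ℤS.∣-trans (ℤS.∣ᵤ⇒∣ (ℕD.∣m⇒∣m*n p ℕD.∣-refl)) p²∣)
                        (ℕD.∣m⇒∣m*n t (ℕD.∣n⇒∣m*n 24 ℕD.∣-refl))
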